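{- Let $e_i$ and $f_j$ be two arbitrary edges of $\mathcal{C}_1$ and $\mathcal{C}_2$, respectively. Assume that $v'$, $v''$, $u'$ and $u''$ are distinct vertices with $v'\in e_{i-1}\setminus\{f_{\mathcal{C}_1,e_{i-1}}\}$, $v''\in e_{i+1}\setminus\{l_{\mathcal{C}_1,e_{i+1}}\}$, $u'\in f_{j-1}\setminus\{f_{\mathcal{C}_2,f_{j-1}}\}$ and $u''\in f_{j+1}\setminus\{l_{\mathcal{C}_2,f_{j+1}}\}$. If there is no blue copy of $\mathcal{C}^k_{l_1+l_2}$, then there is a red loose path $\mathcal{P}=g_1g_2$ such that $V(\mathcal{P})\subseteq (V(e_i)\setminus\{f_{\mathcal{C}_1,e_{i}},l_{\mathcal{C}_1,e_{i}}\})\cup (V(f_j)\setminus\{f_{\mathcal{C}_2,f_{j}},l_{\mathcal{C}_2,f_{j}}\})\cup\{v',v'',u',u''\}$, and $|g_m\cap (e_i\setminus\{f_{\mathcal{C}_1,e_{i}},l_{\mathcal{C}_1,e_{i}}\})|\geq 3$, $|g_m\cap (f_j\setminus\{f_{\mathcal{C}_2,f_{j}},l_{\mathcal{C}_2,f_{j}}\})|\geq 3$ for $m=1,2$.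
   Context: A $k$-uniform loose cycle $\mathcal{C}^k_n$ has vertex set $\{v_1,\ldots,v_{n(k-1)}\}$ and edges $e_i=\{v_{(i-1)(k-1)+1},\ldots,v_{(i-1)(k-1)+k}\}$, $1\le i\le n$, indices mod $n(k-1)$; a loose path is defined analogously without wrap-around. For an edge $e$ of a loose path or loose cycle $\mathcal{K}$, $f_{\mathcal{K},e}$ and $l_{\mathcal{K},e}$ denote the first and last vertex of $e$. Setting: $n\geq 5$, $k\geq 8$, $l_2\geq l_1\geq 2$, $l_1+l_2\leq n$, and $\mathcal{H}=\mathcal{K}^k_{(k-1)n+\lfloor\frac{n-1}{2}\rfloor}$ (complete $k$-uniform hypergraph) is 2-edge-colored red and blue. $\mathcal{C}_1=e_1e_2\ldots e_{l_1}$ and $\mathcal{C}_2=f_1f_2\ldots f_{l_2}$ are two disjoint blue loose cycles with edges $e_i=\{v_1,\ldots,v_k\}+(k-1)(i-1)$ (mod $(k-1)l_1$), $i=1,\ldots,l_1$, and $f_i=\{u_1,\ldots,u_k\}+(k-1)(i-1)$ (mod $(k-1)l_2$), $i=1,\ldots,l_2$ (edge indices taken cyclically), and $W$, with $|W|\geq 2$, is the set of vertices of $\mathcal{H}$ not covered by $\mathcal{C}_1\cup\mathcal{C}_2$. -}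

module Defs where

open import Data.Nat using (ℕ; zero; suc; _+_; _*_; _∸_; _<?_; _/_)
open import Data.Nat.DivMod using (_mod_)
open import Data.Fin using (Fin; toℕ; fromℕ<)
open import Data.Fin.Subset using (Subset; ⁅_⁆; _∪_; _─_; ∁; ⊥)
open import Data.List using (List; []; _∷_; foldr; map; concatMap; upTo; allFin)
open import Data.Product using (_×_)
open import Relation.Nullary using (yes; no)
open import Relation.Binary.PropositionalEquality using (_≡_)
open import Function.Definitions using (Injective)

data Colour : Set where
  red blue : Colour

-- Number of vertices of H = K^k_{(k-1)n + ⌊(n-1)/2⌋}.
Hsize : ℕ → ℕ → ℕ
Hsize n k = (k ∸ 1) * n + (n ∸ 1) / 2

-- A 2-edge-colouring of the complete k-uniform hypergraph on Fin N:
-- every k-subset of Fin N is an edge; its colour is c applied to it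
-- (values of c on subsets of other sizes are irrelevant).
Colouring : ℕ → Set
Colouring N = Subset N → Colour

toSub : ∀ {N} → List (Fin N) → Subset N
toSub = foldr (λ x s → ⁅ x ⁆ ∪ s) ⊥

-- Vertex at cyclic position j (0-based, taken mod L) of a cyclic
-- vertex sequence φ : Fin L → Fin N, as a (singleton) list.
cyc : ∀ {L N} → (Fin L → Fin N) → ℕ → List (Fin N)
cyc {zero}  φ j = []
cyc {suc L} φ j = φ (j mod suc L) ∷ []

atP : ∀ {L N} → (Fin L → Fin N) → ℕ → List (Fin N)
atP {L} φ j with j <? L
... | yes p = φ (fromℕ< p) ∷ []
... | no _  = []

-- Edge with (0-based) index i of the loose cycle with vertex sequence φ:
-- vertices at positions i(k-1), ..., i(k-1)+k-1 (mod length).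
cycEdge : ∀ {L N} → ℕ → (Fin L → Fin N) → ℕ → Subset N
cycEdge k φ i = toSub (concatMap (λ t → cyc φ (i * (k ∸ 1) + t)) (upTo k))

cycFirst : ∀ {L N} → ℕ → (Fin L → Fin N) → ℕ → Subset N
cycFirst k φ i = toSub (cyc φ (i * (k ∸ 1)))

cycLast : ∀ {L N} → ℕ → (Fin L → Fin N) → ℕ → Subset N
cycLast k φ i = toSub (cyc φ (i * (k ∸ 1) + (k ∸ 1)))

cycInner : ∀ {L N} → ℕ → (Fin L → Fin N) → ℕ → Subset N
cycInner k φ i = (cycEdge k φ i ─ cycFirst k φ i) ─ cycLast k φ i

pathEdge : ∀ {L N} → ℕ → (Fin L → Fin N) → ℕ → Subset N
pathEdge k ψ i = toSub (concatMap (λ t → atP ψ (i * (k ∸ 1) + t)) (upTo k))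

image : ∀ {L N} → (Fin L → Fin N) → Subset N
image φ = toSub (map φ (allFin _))

IsLooseCycle : ∀ {N} → Colouring N → Colour → (k m : ℕ) →
               (Fin ((k ∸ 1) * m) → Fin N) → Set
IsLooseCycle c col k m φ =
  Injective _≡_ _≡_ φ × (∀ (i : Fin m) → c (cycEdge k φ (toℕ i)) ≡ col)

IsLoosePath : ∀ {N} → Colouring N → Colour → (k m : ℕ) →
              (Fin ((k ∸ 1) * m + 1) → Fin N) → Set
IsLoosePath c col k m ψ =
  Injective _≡_ _≡_ ψ × (∀ (i : Fin m) → c (pathEdge k ψ (toℕ i)) ≡ col)

-- Write r = k − 2 ≥ 6 and interleave the r inner vertices of e_i with the r inner vertices of f_j into a
-- sequence x of period 2r.  Any r consecutive terms of x contain three inner vertices of each edge, so every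
-- window {p, x_α, …, x_(α+r−1), q} with p ∈ {v′, v″}, q ∈ {u′, u″} meets both inner parts as required.
-- If {v′, x_α …, u″} and {v″, x_(α+r) …, u′} were both blue, they could replace e_i and f_j and join C₁ and
-- C₂ into a blue C_(l₁+l₂); likewise for {v′, x_α …, u′} and {v″, x_(α+r) …, u″}, traversing C₂ backwards.
-- Following the colours of these windows as α runs through a period then yields two red windows forming a
-- loose path: complementary windows sharing an end vertex, or {v″, u′, x_(α+1+r) …} and {v′, u″, x_α …},
-- which share x_α = x_(α+2r).

module Submission where

open import Defs
open import Data.Nat
  using (ℕ; zero; suc; _+_; _*_; _∸_; _≤_; _<_; z≤n; s≤s; _≤?_; _<?_; _≟_; NonZero; >-nonZero; _%_; _/_)
open import Data.Nat.Properties
open import Data.Nat.DivMod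
open import Data.Nat.Divisibility using (n∣m*n)
open import Data.Nat.Solver using (module +-*-Solver)
open import Data.Fin using (Fin; toℕ) renaming (zero to fzero; suc to fsuc; _≟_ to _≟ᶠ_)
import Data.Fin.Properties as Finₚ
open import Data.Fin.Subset using (Subset; _∈_; _∉_; _⊆_; _∪_; _∩_; _-_; ∁; ⁅_⁆; ∣_∣)
import Data.Fin.Subset.Properties as Subsetₚ
open import Data.List using (List; []; _∷_; map; concatMap; applyUpTo; allFin)
open import Data.List.Membership.Propositional using () renaming (_∈_ to _∈ₗ_)
open import Data.List.Membership.Propositional.Properties using (∈-applyUpTo⁺; ∈-applyUpTo⁻; ∈-map⁻)
open import Data.List.Relation.Unary.Any using (here; there)
open import Data.Product using (_×_; _,_; proj₁; proj₂; ∃-syntax)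
open import Data.Sum using (_⊎_; inj₁; inj₂)
open import Data.Empty using (⊥; ⊥-elim)
open import Relation.Binary.PropositionalEquality
open import Relation.Nullary using (¬_; yes; no)
open import Function using (_∘_)
open import Function.Definitions using (Injective)
open +-*-Solver

∈-toSub⁺ : ∀ {N} {x : Fin N} {xs} → x ∈ₗ xs → x ∈ toSub xs
∈-toSub⁺ {xs = y ∷ _} (here refl) = Subsetₚ.x∈p∪q⁺ (inj₁ (Subsetₚ.x∈⁅x⁆ y))
∈-toSub⁺ {xs = _ ∷ _} (there x∈ys) = Subsetₚ.x∈p∪q⁺ (inj₂ (∈-toSub⁺ x∈ys))

∈-toSub⁻ : ∀ {N} {x : Fin N} xs → x ∈ toSub xs → x ∈ₗ xs
∈-toSub⁻ [] x∈⊥ = ⊥-elim (Subsetₚ.∉⊥ x∈⊥)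
∈-toSub⁻ (y ∷ ys) x∈ with Subsetₚ.x∈p∪q⁻ ⁅ y ⁆ (toSub ys) x∈
... | inj₁ x∈⁅y⁆ = here (Subsetₚ.x∈⁅y⁆⇒x≡y y x∈⁅y⁆)
... | inj₂ x∈ys = there (∈-toSub⁻ ys x∈ys)

∈-toSub-[_]⁻ : ∀ {N} {x : Fin N} y → x ∈ toSub (y ∷ []) → x ≡ y
∈-toSub-[ y ]⁻ x∈ with ∈-toSub⁻ (y ∷ []) x∈
... | here x≡y = x≡y

toSub-cong : ∀ {N} {xs ys : List (Fin N)} →
             (∀ {x} → x ∈ₗ xs → x ∈ₗ ys) → (∀ {x} → x ∈ₗ ys → x ∈ₗ xs) → toSub xs ≡ toSub ys
toSub-cong {xs = xs} {ys} xs⊆ys ys⊆xs = Subsetₚ.⊆-antisym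
  (λ x∈ → ∈-toSub⁺ (xs⊆ys (∈-toSub⁻ xs x∈))) (λ x∈ → ∈-toSub⁺ (ys⊆xs (∈-toSub⁻ ys x∈)))

3≤∣p∣ : ∀ {N} {p : Subset N} {x y z : Fin N} → x ∈ p → y ∈ p → z ∈ p → x ≢ y → x ≢ z → y ≢ z → 3 ≤ ∣ p ∣
3≤∣p∣ {p = p} {x} {y} {z} x∈p y∈p z∈p x≢y x≢z y≢z =
  ≤-trans (s≤s (≤-trans (s≤s (≤-trans (s≤s z≤n) (smaller z∈p-x-y))) (smaller y∈p-x))) (smaller x∈p)
  where
  open Subsetₚ using (x∈p∧x≢y⇒x∈p-y) renaming (x∈p⇒∣p-x∣<∣p∣ to smaller)
  y∈p-x : y ∈ p - x
  y∈p-x = x∈p∧x≢y⇒x∈p-y y∈p (x≢y ∘ sym)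
  z∈p-x-y : z ∈ p - x - y
  z∈p-x-y = x∈p∧x≢y⇒x∈p-y (x∈p∧x≢y⇒x∈p-y z∈p (x≢z ∘ sym)) (y≢z ∘ sym)

applyUpTo-cong : ∀ {A : Set} {f g : ℕ → A} n → (∀ {t} → t < n → f t ≡ g t) → applyUpTo f n ≡ applyUpTo g n
applyUpTo-cong zero f≗g = refl
applyUpTo-cong (suc n) f≗g = cong₂ _∷_ (f≗g (s≤s z≤n)) (applyUpTo-cong n (λ t<n → f≗g (s≤s t<n)))

concatMap-applyUpTo : ∀ {A B : Set} (g : A → List B) (h : A → B) (f : ℕ → A) n →
                      (∀ {t} → t < n → g (f t) ≡ h (f t) ∷ []) →
                      concatMap g (applyUpTo f n) ≡ applyUpTo (h ∘ f) n
concatMap-applyUpTo g h f zero g≗[h] = refl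
concatMap-applyUpTo g h f (suc n) g≗[h] rewrite g≗[h] {0} (s≤s z≤n) =
  cong (h (f 0) ∷_) (concatMap-applyUpTo g h (f ∘ suc) n (λ t<n → g≗[h] (s≤s t<n)))

InRange : ℕ → ℕ → ℕ → Set
InRange lo hi o = lo ≤ o × o ≤ hi

toSub-applyUpTo-involution : ∀ {N} (f : ℕ → Fin N) (τ : ℕ → ℕ) a n →
  (∀ o → InRange a (a + n) o → τ (τ o) ≡ o) → (∀ o → InRange a (a + n) o → InRange a (a + n) (τ o)) →
  toSub (applyUpTo (λ t → f (τ (a + t))) (suc n)) ≡ toSub (applyUpTo (λ t → f (a + t)) (suc n))
toSub-applyUpTo-involution f τ a n τ-involutive τ-range = toSub-cong forth back
  where
  in-range : ∀ {t} → t < suc n → InRange a (a + n) (a + t)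
  in-range (s≤s t≤n) = m≤m+n a _ , +-monoʳ-≤ a t≤n
  offset-of-τ : ∀ {t} → t < suc n → ∃[ t′ ] (t′ < suc n × a + t′ ≡ τ (a + t))
  offset-of-τ t<1+n with τ-range _ (in-range t<1+n)
  ... | a≤ , ≤a+n = _ , s≤s (+-cancelˡ-≤ a _ _ (subst (_≤ a + n) (sym (m+[n∸m]≡n a≤)) ≤a+n)) , m+[n∸m]≡n a≤
  forth : ∀ {y} → y ∈ₗ applyUpTo (λ t → f (τ (a + t))) (suc n) → y ∈ₗ applyUpTo (λ t → f (a + t)) (suc n)
  forth y∈ with ∈-applyUpTo⁻ (λ t → f (τ (a + t))) y∈
  ... | t , t<1+n , refl with offset-of-τ t<1+n
  ...   | t′ , t′<1+n , eq = subst (_∈ₗ applyUpTo (λ t → f (a + t)) (suc n)) (cong f eq)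
                                   (∈-applyUpTo⁺ (λ t → f (a + t)) t′<1+n)
  back : ∀ {y} → y ∈ₗ applyUpTo (λ t → f (a + t)) (suc n) → y ∈ₗ applyUpTo (λ t → f (τ (a + t))) (suc n)
  back y∈ with ∈-applyUpTo⁻ (λ t → f (a + t)) y∈
  ... | t , t<1+n , refl with offset-of-τ t<1+n
  ...   | t′ , t′<1+n , eq = subst (_∈ₗ applyUpTo (λ t → f (τ (a + t))) (suc n))
                                   (cong f (trans (cong τ eq) (τ-involutive _ (in-range t<1+n))))
                                   (∈-applyUpTo⁺ (λ t → f (τ (a + t))) t′<1+n)

%-cancelˡ-+ : ∀ a o o′ L .{{_ : NonZero L}} → (a + o) % L ≡ (a + o′) % L → o % L ≡ o′ % L
%-cancelˡ-+ a o o′ L eq = trans (shift o) (trans (cong (λ z → (b % L + z) % L) eq) (sym (shift o′)))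
  where
  open ≡-Reasoning
  b : ℕ
  b = L ∸ a % L
  b+a≡0 : (b + a) % L ≡ 0
  b+a≡0 = begin
    (b + a) % L                     ≡⟨ cong (λ z → (b + z) % L) (m≡m%n+[m/n]*n a L) ⟩
    (b + (a % L + a / L * L)) % L   ≡⟨ cong (_% L) (sym (+-assoc b (a % L) (a / L * L))) ⟩
    (b + a % L + a / L * L) % L     ≡⟨ [m+kn]%n≡m%n (b + a % L) (a / L) L ⟩
    (b + a % L) % L                 ≡⟨ cong (_% L) (m∸n+n≡m (<⇒≤ (m%n<n a L))) ⟩
    L % L                           ≡⟨ n%n≡0 L ⟩
    0                               ∎
  shift : ∀ o → o % L ≡ (b % L + (a + o) % L) % L
  shift o = begin
    o % L                         ≡⟨ sym (m%n%n≡m%n o L) ⟩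
    (0 + o % L) % L               ≡⟨ cong (λ z → (z + o % L) % L) (sym b+a≡0) ⟩
    ((b + a) % L + o % L) % L     ≡⟨ sym (%-distribˡ-+ (b + a) o L) ⟩
    (b + a + o) % L               ≡⟨ cong (_% L) (+-assoc b a o) ⟩
    (b + (a + o)) % L             ≡⟨ %-distribˡ-+ b (a + o) L ⟩
    (b % L + (a + o) % L) % L     ∎

%-injective-[1,n] : ∀ {o o′ L} .{{_ : NonZero L}} → 1 ≤ o → o ≤ L → 1 ≤ o′ → o′ ≤ L → o % L ≡ o′ % L → o ≡ o′
%-injective-[1,n] {o} {o′} {L} 1≤o o≤L 1≤o′ o′≤L eq with m≤n⇒m<n∨m≡n o≤L | m≤n⇒m<n∨m≡n o′≤L
... | inj₁ o<L  | inj₁ o′<L = trans (sym (m<n⇒m%n≡m o<L)) (trans eq (m<n⇒m%n≡m o′<L))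
... | inj₂ refl | inj₂ refl = refl
... | inj₁ o<L  | inj₂ refl = ⊥-elim (<⇒≢ 1≤o (sym (trans (sym (m<n⇒m%n≡m o<L)) (trans eq (n%n≡0 L)))))
... | inj₂ refl | inj₁ o′<L = ⊥-elim (<⇒≢ 1≤o′ (sym (trans (sym (m<n⇒m%n≡m o′<L)) (trans (sym eq) (n%n≡0 L)))))

+-%-injectiveʳ : ∀ a {q q′ L} .{{_ : NonZero L}} → q < L → q′ < L → (a + q) % L ≡ (a + q′) % L → q ≡ q′
+-%-injectiveʳ a {q} {q′} {L} q<L q′<L eq =
  trans (sym (m<n⇒m%n≡m q<L)) (trans (%-cancelˡ-+ a q q′ L eq) (m<n⇒m%n≡m q′<L))

toℕ-mod : ∀ a L .{{_ : NonZero L}} → toℕ (a mod L) ≡ a % L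
toℕ-mod a L = Finₚ.toℕ-fromℕ< (m%n<n a L)

mod-cong : ∀ a b L .{{_ : NonZero L}} → a % L ≡ b % L → a mod L ≡ b mod L
mod-cong a b L eq = Finₚ.toℕ-injective (trans (toℕ-mod a L) (trans eq (sym (toℕ-mod b L))))

swap : ℕ → ℕ → ℕ → ℕ
swap a b o with o ≟ a
... | yes _ = b
... | no _ with o ≟ b
...   | yes _ = a
...   | no _ = o

swap-a : ∀ a b → swap a b a ≡ b
swap-a a b with a ≟ a
... | yes _ = refl
... | no a≢a = ⊥-elim (a≢a refl)

swap-b : ∀ a b → swap a b b ≡ a
swap-b a b with b ≟ a
... | yes b≡a = b≡a
... | no _ with b ≟ b
...   | yes _ = refl
...   | no b≢b = ⊥-elim (b≢b refl)

swap-other : ∀ a b o → o ≢ a → o ≢ b → swap a b o ≡ o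
swap-other a b o o≢a o≢b with o ≟ a
... | yes o≡a = ⊥-elim (o≢a o≡a)
... | no _ with o ≟ b
...   | yes o≡b = ⊥-elim (o≢b o≡b)
...   | no _ = refl

data SwapCase (a b o : ℕ) : Set where
  is-a : o ≡ a → SwapCase a b o
  is-b : o ≡ b → o ≢ a → SwapCase a b o
  other : o ≢ a → o ≢ b → SwapCase a b o

swapCase : ∀ a b o → SwapCase a b o
swapCase a b o with o ≟ a
... | yes o≡a = is-a o≡a
... | no o≢a with o ≟ b
...   | yes o≡b = is-b o≡b o≢a
...   | no o≢b = other o≢a o≢b

swap-involutive : ∀ a b o → swap a b (swap a b o) ≡ o
swap-involutive a b o with swapCase a b o
... | is-a refl = trans (cong (swap a b) (swap-a a b)) (swap-b a b)
... | is-b refl _ = trans (cong (swap a b) (swap-b a b)) (swap-a a b)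
... | other o≢a o≢b = trans (cong (swap a b) (swap-other a b o o≢a o≢b)) (swap-other a b o o≢a o≢b)

swap-comm : ∀ a b c d → a ≢ c → a ≢ d → b ≢ c → b ≢ d → ∀ o → swap a b (swap c d o) ≡ swap c d (swap a b o)
swap-comm a b c d a≢c a≢d b≢c b≢d o with swapCase c d o | swapCase a b o
... | is-a refl   | is-a o≡a     = ⊥-elim (a≢c (sym o≡a))
... | is-a refl   | is-b o≡b _   = ⊥-elim (b≢c (sym o≡b))
... | is-a refl   | other o≢a o≢b =
  trans (cong (swap a b) (swap-a o d)) (trans (swap-other a b d (a≢d ∘ sym) (b≢d ∘ sym))
    (sym (trans (cong (swap o d) (swap-other a b o o≢a o≢b)) (swap-a o d))))
... | is-b refl _ | is-a o≡a     = ⊥-elim (a≢d (sym o≡a))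
... | is-b refl _ | is-b o≡b _   = ⊥-elim (b≢d (sym o≡b))
... | is-b refl _ | other o≢a o≢b =
  trans (cong (swap a b) (swap-b c o)) (trans (swap-other a b c (a≢c ∘ sym) (b≢c ∘ sym))
    (sym (trans (cong (swap c o) (swap-other a b o o≢a o≢b)) (swap-b c o))))
... | other o≢c o≢d | is-a refl =
  trans (cong (swap o b) (swap-other c d o o≢c o≢d)) (trans (swap-a o b)
    (sym (trans (cong (swap c d) (swap-a o b)) (swap-other c d b b≢c b≢d))))
... | other o≢c o≢d | is-b refl _ =
  trans (cong (swap a o) (swap-other c d o o≢c o≢d)) (trans (swap-b a o)
    (sym (trans (cong (swap c d) (swap-b a o)) (swap-other c d a a≢c a≢d))))
... | other o≢c o≢d | other o≢a o≢b =
  trans (cong (swap a b) (swap-other c d o o≢c o≢d)) (trans (swap-other a b o o≢a o≢b)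
    (sym (trans (cong (swap c d) (swap-other a b o o≢a o≢b)) (swap-other c d o o≢c o≢d))))

data SameSide (lo hi a b : ℕ) : Set where
  both-inside : InRange lo hi a → InRange lo hi b → SameSide lo hi a b
  both-below : a < lo → b < lo → SameSide lo hi a b
  both-above : hi < a → hi < b → SameSide lo hi a b

swap-preserves-range : ∀ {lo hi a b} → SameSide lo hi a b → ∀ o → InRange lo hi o → InRange lo hi (swap a b o)
swap-preserves-range {lo} {hi} {a} {b} side o o∈ with swapCase a b o
... | is-a refl = subst (InRange lo hi) (sym (swap-a o b)) (other-inside side o∈)
  where
  other-inside : SameSide lo hi o b → InRange lo hi o → InRange lo hi b
  other-inside (both-inside _ b∈) _ = b∈
  other-inside (both-below o<lo _) (lo≤o , _) = ⊥-elim (<⇒≱ o<lo lo≤o)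
  other-inside (both-above hi<o _) (_ , o≤hi) = ⊥-elim (<⇒≱ hi<o o≤hi)
... | is-b refl _ = subst (InRange lo hi) (sym (swap-b a o)) (other-inside side o∈)
  where
  other-inside : SameSide lo hi a o → InRange lo hi o → InRange lo hi a
  other-inside (both-inside a∈ _) _ = a∈
  other-inside (both-below _ o<lo) (lo≤o , _) = ⊥-elim (<⇒≱ o<lo lo≤o)
  other-inside (both-above _ hi<o) (_ , o≤hi) = ⊥-elim (<⇒≱ hi<o o≤hi)
... | other o≢a o≢b = subst (InRange lo hi) (sym (swap-other a b o o≢a o≢b)) o∈

cyc-nonZero : ∀ {L N} (φ : Fin L → Fin N) .{{_ : NonZero L}} j → cyc φ j ≡ φ (j mod L) ∷ []
cyc-nonZero {suc L} φ j = refl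

module SequenceAsCycle {N : ℕ} (k₋₁ L : ℕ) .{{_ : NonZero L}} (S : ℕ → Fin N) where

  cycle : Fin L → Fin N
  cycle = S ∘ toℕ

  cycle-injective : (∀ p p′ → p < L → p′ < L → S p ≡ S p′ → p ≡ p′) → Injective _≡_ _≡_ cycle
  cycle-injective S-inj {p} {p′} eq = Finₚ.toℕ-injective (S-inj _ _ (Finₚ.toℕ<n p) (Finₚ.toℕ<n p′) eq)

  cycEdge-cycle : ∀ e → e * k₋₁ + k₋₁ ≤ L → S L ≡ S 0 →
                  cycEdge (suc k₋₁) cycle e ≡ toSub (applyUpTo (λ t → S (e * k₋₁ + t)) (suc k₋₁))
  cycEdge-cycle e end≤L S-periodic = cong toSub
    (concatMap-applyUpTo (λ t → cyc cycle (e * k₋₁ + t)) (λ t → S (e * k₋₁ + t)) (λ t → t) (suc k₋₁) vertex)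
    where
    wrap : ∀ {o} → o ≤ L → S (o % L) ≡ S o
    wrap o≤L with m≤n⇒m<n∨m≡n o≤L
    ... | inj₁ o<L = cong S (m<n⇒m%n≡m o<L)
    ... | inj₂ refl = trans (cong S (n%n≡0 L)) (sym S-periodic)
    vertex : ∀ {t} → t < suc k₋₁ → cyc cycle (e * k₋₁ + t) ≡ S (e * k₋₁ + t) ∷ []
    vertex (s≤s t≤k₋₁) = trans (cyc-nonZero cycle (e * k₋₁ + _))
      (cong (_∷ []) (trans (cong S (toℕ-mod _ L)) (wrap (≤-trans (+-monoʳ-≤ (e * k₋₁) t≤k₋₁) end≤L))))

module SequenceAsPath {N : ℕ} (k₋₁ : ℕ) (S : ℕ → Fin N) where

  path : Fin (k₋₁ * 2 + 1) → Fin N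
  path = S ∘ toℕ

  path-injective : (∀ p p′ → p < k₋₁ * 2 + 1 → p′ < k₋₁ * 2 + 1 → S p ≡ S p′ → p ≡ p′) → Injective _≡_ _≡_ path
  path-injective S-inj {p} {p′} eq = Finₚ.toℕ-injective (S-inj _ _ (Finₚ.toℕ<n p) (Finₚ.toℕ<n p′) eq)

  atP-path : ∀ {j} → j < k₋₁ * 2 + 1 → atP path j ≡ S j ∷ []
  atP-path {j} j<len with j <? k₋₁ * 2 + 1
  ... | yes j<len′ = cong (λ z → S z ∷ []) (Finₚ.toℕ-fromℕ< j<len′)
  ... | no j≮len = ⊥-elim (j≮len j<len)

  pathEdge-path : ∀ e → e * k₋₁ + k₋₁ < k₋₁ * 2 + 1 →
                  pathEdge (suc k₋₁) path e ≡ toSub (applyUpTo (λ t → S (e * k₋₁ + t)) (suc k₋₁))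
  pathEdge-path e end<len = cong toSub (concatMap-applyUpTo (λ t → atP path (e * k₋₁ + t)) (λ t → S (e * k₋₁ + t))
    (λ t → t) (suc k₋₁) (λ t<k → atP-path (≤-<-trans (+-monoʳ-≤ (e * k₋₁) (≤-pred t<k)) end<len)))

  image-path : ∀ {P : Fin N → Set} → (∀ p → p < k₋₁ * 2 + 1 → P (S p)) → ∀ {y} → y ∈ image path → P y
  image-path P∘S y∈ with ∈-map⁻ path (∈-toSub⁻ (map path (allFin _)) y∈)
  ... | p , _ , refl = P∘S (toℕ p) (Finₚ.toℕ<n p)

module OnCycle {N : ℕ} (c : Colouring N) (r m : ℕ) (φ : Fin (suc r * suc m) → Fin N)
               (isCycle : IsLooseCycle c blue (suc (suc r)) (suc m) φ) (i : ℕ) where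

  k₋₁ k L : ℕ
  k₋₁ = suc r
  k = suc k₋₁
  L = k₋₁ * suc m

  -- The cycle read from the first vertex of e_i: edge e_(i+d) is V (d k₋₁), …, V (d k₋₁ + k₋₁).
  V : ℕ → Fin N
  V o = φ ((i * k₋₁ + o) mod L)

  V-injective : ∀ {o o′} → 1 ≤ o → o ≤ L → 1 ≤ o′ → o′ ≤ L → V o ≡ V o′ → o ≡ o′
  V-injective 1≤o o≤L 1≤o′ o′≤L eq = %-injective-[1,n] 1≤o o≤L 1≤o′ o′≤L (%-cancelˡ-+ (i * k₋₁) _ _ L
    (trans (sym (toℕ-mod (i * k₋₁ + _) L)) (trans (cong toℕ (proj₁ isCycle eq)) (toℕ-mod (i * k₋₁ + _) L))))

  V-periodic : V L ≡ V 0
  V-periodic = cong φ (mod-cong (i * k₋₁ + L) (i * k₋₁ + 0) L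
    (trans ([m+n]%n≡m%n (i * k₋₁) L) (cong (_% L) (sym (+-identityʳ (i * k₋₁))))))

  edge : ℕ → Subset N
  edge d = toSub (applyUpTo (λ t → V (d * k₋₁ + t)) k)

  private
    shift : ∀ d t → (i + d) * k₋₁ + t ≡ i * k₋₁ + (d * k₋₁ + t)
    shift d t = solve 4 (λ i d t κ → (i :+ d) :* κ :+ t := i :* κ :+ (d :* κ :+ t)) refl i d t k₋₁

    -- L = k₋₁ (m + 1), so a position e k₋₁ + t only depends on e modulo m + 1.
    reduce : ∀ a t → (a * k₋₁ + t) % L ≡ (a % suc m * k₋₁ + t) % L
    reduce a t = begin
      (a * k₋₁ + t) % L                                ≡⟨ cong (λ z → (z * k₋₁ + t) % L) (m≡m%n+[m/n]*n a (suc m)) ⟩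
      ((a % suc m + a / suc m * suc m) * k₋₁ + t) % L  ≡⟨ cong (_% L) (solve 5 (λ A Q M κ t →
                                                           (A :+ Q :* M) :* κ :+ t := A :* κ :+ t :+ Q :* (κ :* M))
                                                           refl (a % suc m) (a / suc m) (suc m) k₋₁ t) ⟩
      (a % suc m * k₋₁ + t + a / suc m * L) % L        ≡⟨ [m+kn]%n≡m%n (a % suc m * k₋₁ + t) (a / suc m) L ⟩
      (a % suc m * k₋₁ + t) % L                        ∎
      where open ≡-Reasoning

    cyc-at : ∀ e d t → e % suc m ≡ (i + d) % suc m → cyc φ (e * k₋₁ + t) ≡ V (d * k₋₁ + t) ∷ []
    cyc-at e d t e≡ = trans (cyc-nonZero φ (e * k₋₁ + t)) (cong (λ z → φ z ∷ []) (mod-cong (e * k₋₁ + t) (i * k₋₁ + (d * k₋₁ + t)) L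
      (trans (reduce e t) (trans (cong (λ z → (z * k₋₁ + t) % L) e≡)
        (trans (sym (reduce (i + d) t)) (cong (_% L) (shift d t)))))))

  cycEdge≡edge : ∀ e d → e % suc m ≡ (i + d) % suc m → cycEdge k φ e ≡ edge d
  cycEdge≡edge e d e≡ = cong toSub (concatMap-applyUpTo (λ t → cyc φ (e * k₋₁ + t)) (λ t → V (d * k₋₁ + t))
    (λ t → t) k (λ {t} _ → cyc-at e d t e≡))

  cycFirst≡ : ∀ {e} d → e ≡ i + d → cycFirst k φ e ≡ toSub (V (d * k₋₁ + 0) ∷ [])
  cycFirst≡ {e} d e≡ = cong toSub (trans (cong (cyc φ) (sym (+-identityʳ (e * k₋₁)))) (cyc-at e d 0 (cong (_% suc m) e≡)))

  cycLast≡ : ∀ {e} d → e ≡ i + d → cycLast k φ e ≡ toSub (V (d * k₋₁ + k₋₁) ∷ [])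
  cycLast≡ {e} d e≡ = cong toSub (cyc-at e d k₋₁ (cong (_% suc m) e≡))

  edge-blue : ∀ d → c (edge d) ≡ blue
  edge-blue d = trans (cong c (sym (cycEdge≡edge (toℕ ((i + d) mod suc m)) d index≡))) (proj₂ isCycle ((i + d) mod suc m))
    where
    index≡ : toℕ ((i + d) mod suc m) % suc m ≡ (i + d) % suc m
    index≡ = trans (cong (_% suc m) (toℕ-mod (i + d) (suc m))) (m%n%n≡m%n (i + d) (suc m))

  V∈inner : ∀ q → q < r → V (suc q) ∈ cycInner k φ i
  V∈inner q q<r = x∈p∧x∉q⇒x∈p─q (x∈p∧x∉q⇒x∈p─q V∈edge V∉first) V∉last
    where
    open Subsetₚ using (x∈p∧x∉q⇒x∈p─q)
    i≡ : i ≡ i + 0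
    i≡ = sym (+-identityʳ i)
    1+q≤L : suc q ≤ L
    1+q≤L = ≤-trans (m≤n⇒m≤1+n q<r) (m≤m*n k₋₁ (suc m))
    V∈edge : V (suc q) ∈ cycEdge k φ i
    V∈edge = subst (V (suc q) ∈_) (sym (cycEdge≡edge i 0 (cong (_% suc m) i≡)))
                   (∈-toSub⁺ (∈-applyUpTo⁺ (λ t → V (0 * k₋₁ + t)) (s≤s (m≤n⇒m≤1+n q<r))))
    V∉first : V (suc q) ∉ cycFirst k φ i
    V∉first V∈ rewrite cycFirst≡ 0 i≡ = <⇒≢ (<-≤-trans (s≤s q<r) (m≤m*n k₋₁ (suc m)))
      (V-injective (s≤s z≤n) 1+q≤L (≤-trans (s≤s z≤n) (m≤m*n k₋₁ (suc m))) ≤-refl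
                   (trans (∈-toSub-[ V (0 * k₋₁ + 0) ]⁻ V∈) (sym V-periodic)))
    V∉last : V (suc q) ∉ cycLast k φ i
    V∉last V∈ rewrite cycLast≡ 0 i≡ = <⇒≢ (s≤s q<r)
      (V-injective (s≤s z≤n) 1+q≤L (s≤s z≤n) (m≤m*n k₋₁ (suc m)) (∈-toSub-[ V (0 * k₋₁ + k₋₁) ]⁻ V∈))

  ∈-cycEdge⁻ : ∀ {v} e d → e ≡ i + d → v ∈ cycEdge k φ e → ∃[ t ] (t < k × v ≡ V (d * k₋₁ + t))
  ∈-cycEdge⁻ {v} e d e≡ v∈ = ∈-applyUpTo⁻ (λ t → V (d * k₋₁ + t))
    (∈-toSub⁻ (applyUpTo (λ t → V (d * k₋₁ + t)) k) (subst (v ∈_) (cycEdge≡edge e d (cong (_% suc m) e≡)) v∈))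

  pred-vertex : ∀ {v} → v ∈ cycEdge k φ (i + suc m ∸ 1) → v ∉ cycFirst k φ (i + suc m ∸ 1) →
                ∃[ t ] (1 ≤ t × t ≤ k₋₁ × v ≡ V (m * k₋₁ + t))
  pred-vertex {v} v∈ v∉first with ∈-cycEdge⁻ _ m e≡ v∈
    where
    e≡ : i + suc m ∸ 1 ≡ i + m
    e≡ = cong (_∸ 1) (+-suc i m)
  ... | zero , _ , refl = ⊥-elim (v∉first (subst (v ∈_) (sym (cycFirst≡ m (cong (_∸ 1) (+-suc i m))))
                                                       (∈-toSub⁺ {xs = V (m * k₋₁ + 0) ∷ []} (here refl))))
  ... | suc t , s≤s t≤k₋₁ , v≡ = suc t , s≤s z≤n , t≤k₋₁ , v≡

  succ-vertex : ∀ {v} → v ∈ cycEdge k φ (i + 1) → v ∉ cycLast k φ (i + 1) → ∃[ t ] (t ≤ r × v ≡ V (k₋₁ + t))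
  succ-vertex {v} v∈ v∉last with ∈-cycEdge⁻ (i + 1) 1 refl v∈
  ... | t , s≤s t≤k₋₁ , v≡ with m≤n⇒m<n∨m≡n t≤k₋₁
  ...   | inj₁ t<k₋₁ = t , ≤-pred t<k₋₁ , trans v≡ (cong (λ z → V (z + t)) (*-identityˡ k₋₁))
  ...   | inj₂ refl = ⊥-elim (v∉last (subst (v ∈_) (sym (cycLast≡ 1 refl))
                                            (∈-toSub⁺ {xs = V (1 * k₋₁ + k₋₁) ∷ []} (here v≡))))

%2≡0⊎%2≡1 : ∀ y → y % 2 ≡ 0 ⊎ y % 2 ≡ 1
%2≡0⊎%2≡1 y with y % 2 | m%n<n y 2
... | 0 | _ = inj₁ refl
... | 1 | _ = inj₂ refl
... | suc (suc _) | s≤s (s≤s ())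

record TwoCycles (N : ℕ) : Set where
  field
    c : Colouring N
    r : ℕ
    6≤r : 6 ≤ r
    m₁ m₂ i j : ℕ
    φ₁ : Fin (suc r * suc m₁) → Fin N
    φ₂ : Fin (suc r * suc m₂) → Fin N
    cycle₁ : IsLooseCycle c blue (suc (suc r)) (suc m₁) φ₁
    cycle₂ : IsLooseCycle c blue (suc (suc r)) (suc m₂) φ₂
    disjoint : ∀ a b → φ₁ a ≢ φ₂ b

module Interleaving {N : ℕ} (P : TwoCycles N) where
  open TwoCycles P

  open OnCycle c r m₁ φ₁ cycle₁ i public using (k₋₁; k)
    renaming (L to L₁; V to V₁; V-injective to V₁-injective; edge-blue to edge₁-blue;
              V∈inner to V₁∈inner; pred-vertex to pred-vertex₁; succ-vertex to succ-vertex₁)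
  open OnCycle c r m₂ φ₂ cycle₂ j public using ()
    renaming (L to L₂; V to V₂; V-injective to V₂-injective; edge-blue to edge₂-blue;
              V∈inner to V₂∈inner; pred-vertex to pred-vertex₂; succ-vertex to succ-vertex₂)

  V₁≢V₂ : ∀ o o′ → V₁ o ≢ V₂ o′
  V₁≢V₂ o o′ = disjoint _ _

  k₋₁≤L₁ : k₋₁ ≤ L₁
  k₋₁≤L₁ = m≤m*n k₋₁ (suc m₁)
  k₋₁≤L₂ : k₋₁ ≤ L₂
  k₋₁≤L₂ = m≤m*n k₋₁ (suc m₂)

  period : ℕ
  period = r * 2
  instance
    period-nonZero : NonZero period
    period-nonZero = >-nonZero (≤-trans (≤-trans (s≤s z≤n) 6≤r) (m≤m*n r 2))

  r+r≡period : r + r ≡ period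
  r+r≡period = solve 1 (λ r → r :+ r := r :* con 2) refl r

  6≤period : 6 ≤ period
  6≤period = ≤-trans 6≤r (m≤m*n r 2)

  private
    side : ℕ → ℕ → Fin N
    side zero q = V₁ (suc q)
    side (suc _) q = V₂ (suc q)

  -- x alternates between the inner vertices V₁ 1, …, V₁ r of e_i and V₂ 1, …, V₂ r of f_j.
  x : ℕ → Fin N
  x y = side ((y % period) % 2) ((y % period) / 2)

  x-periodic : ∀ y → x (y + period) ≡ x y
  x-periodic y = cong (λ z → side (z % 2) (z / 2)) ([m+n]%n≡m%n y period)

  private
    parity : ∀ y → (y % period) % 2 ≡ y % 2
    parity y = m∣n⇒o%n%m≡o%m 2 period y (n∣m*n r)

    half<r : ∀ {z} → z < period → z / 2 < r
    half<r = m<n*o⇒m/o<n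

    1+q≤L₁ : ∀ {q} → q < r → suc q ≤ L₁
    1+q≤L₁ q<r = ≤-trans (m≤n⇒m≤1+n q<r) k₋₁≤L₁
    1+q≤L₂ : ∀ {q} → q < r → suc q ≤ L₂
    1+q≤L₂ q<r = ≤-trans (m≤n⇒m≤1+n q<r) k₋₁≤L₂

  x-even : ∀ y → y % 2 ≡ 0 → ∃[ q ] (q < r × x y ≡ V₁ (suc q))
  x-even y even with (y % period) % 2 | parity y
  ... | zero  | _ = _ , half<r (m%n<n y period) , refl
  ... | suc _ | eq = ⊥-elim (0≢1+n (trans (sym even) (sym eq)))

  x-odd : ∀ y → y % 2 ≡ 1 → ∃[ q ] (q < r × x y ≡ V₂ (suc q))
  x-odd y odd with (y % period) % 2 | parity y
  ... | suc _ | _ = _ , half<r (m%n<n y period) , refl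
  ... | zero  | eq = ⊥-elim (0≢1+n (trans eq odd))

  x-cases : ∀ y → (∃[ q ] (q < r × x y ≡ V₁ (suc q))) ⊎ (∃[ q ] (q < r × x y ≡ V₂ (suc q)))
  x-cases y with %2≡0⊎%2≡1 y
  ... | inj₁ even = inj₁ (x-even y even)
  ... | inj₂ odd = inj₂ (x-odd y odd)

  x-injective-mod : ∀ y y′ → x y ≡ x y′ → y % period ≡ y′ % period
  x-injective-mod y y′ eq = begin
    z                    ≡⟨ m≡m%n+[m/n]*n z 2 ⟩
    z % 2 + z / 2 * 2    ≡⟨ cong₂ (λ a b → a + b * 2) (proj₁ (same eq)) (proj₂ (same eq)) ⟩
    z′ % 2 + z′ / 2 * 2  ≡⟨ sym (m≡m%n+[m/n]*n z′ 2) ⟩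
    z′                   ∎
    where
    open ≡-Reasoning
    z z′ : ℕ
    z = y % period
    z′ = y′ % period
    q<r : z / 2 < r
    q<r = half<r (m%n<n y period)
    q′<r : z′ / 2 < r
    q′<r = half<r (m%n<n y′ period)
    same : x y ≡ x y′ → (z % 2 ≡ z′ % 2) × (z / 2 ≡ z′ / 2)
    same eq with z % 2 | z′ % 2 | %2≡0⊎%2≡1 z | %2≡0⊎%2≡1 z′ | eq
    ... | zero | zero | _ | _ | e =
      refl , suc-injective (V₁-injective (s≤s z≤n) (1+q≤L₁ q<r) (s≤s z≤n) (1+q≤L₁ q′<r) e)
    ... | zero | suc _ | _ | _ | e = ⊥-elim (V₁≢V₂ _ _ e)
    ... | suc _ | zero | _ | _ | e = ⊥-elim (V₁≢V₂ _ _ (sym e))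
    ... | suc zero | suc zero | _ | _ | e =
      refl , suc-injective (V₂-injective (s≤s z≤n) (1+q≤L₂ q<r) (s≤s z≤n) (1+q≤L₂ q′<r) e)
    ... | suc (suc _) | _ | inj₁ () | _ | _
    ... | suc (suc _) | _ | inj₂ () | _ | _
    ... | suc zero | suc (suc _) | _ | inj₁ () | _
    ... | suc zero | suc (suc _) | _ | inj₂ () | _

  x-window-injective : ∀ α {q q′} → q < period → q′ < period → x (α + q) ≡ x (α + q′) → q ≡ q′
  x-window-injective α q< q′< eq = +-%-injectiveʳ α q< q′< (x-injective-mod _ _ eq)

  x≢V₁ : ∀ y {o} → k₋₁ ≤ o → o ≤ L₁ → x y ≢ V₁ o
  x≢V₁ y k₋₁≤o o≤L₁ eq with x-cases y
  ... | inj₁ (q , q<r , x≡) = <⇒≢ (≤-trans (s≤s q<r) k₋₁≤o)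
    (V₁-injective (s≤s z≤n) (1+q≤L₁ q<r) (≤-trans (s≤s z≤n) k₋₁≤o) o≤L₁ (trans (sym x≡) eq))
  ... | inj₂ (q , _ , x≡) = V₁≢V₂ _ _ (sym (trans (sym x≡) eq))

  x≢V₂ : ∀ y {o} → k₋₁ ≤ o → o ≤ L₂ → x y ≢ V₂ o
  x≢V₂ y k₋₁≤o o≤L₂ eq with x-cases y
  ... | inj₂ (q , q<r , x≡) = <⇒≢ (≤-trans (s≤s q<r) k₋₁≤o)
    (V₂-injective (s≤s z≤n) (1+q≤L₂ q<r) (≤-trans (s≤s z≤n) k₋₁≤o) o≤L₂ (trans (sym x≡) eq))
  ... | inj₁ (q , _ , x≡) = V₁≢V₂ _ _ (trans (sym x≡) eq)

  x∈inner : ∀ y → x y ∈ cycInner k φ₁ i ⊎ x y ∈ cycInner k φ₂ j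
  x∈inner y with x-cases y
  ... | inj₁ (q , q<r , x≡) = inj₁ (subst (_∈ cycInner k φ₁ i) (sym x≡) (V₁∈inner q q<r))
  ... | inj₂ (q , q<r , x≡) = inj₂ (subst (_∈ cycInner k φ₂ j) (sym x≡) (V₂∈inner q q<r))

  windowSeq : Fin N → Fin N → ℕ → ℕ → Fin N
  windowSeq p q β zero = p
  windowSeq p q β (suc s) with s <? r
  ... | yes _ = x (β + s)
  ... | no _ = q

  windowSeq-inner : ∀ p q β {s} → s < r → windowSeq p q β (suc s) ≡ x (β + s)
  windowSeq-inner p q β {s} s<r with s <? r
  ... | yes _ = refl
  ... | no s≮r = ⊥-elim (s≮r s<r)

  windowSeq-last : ∀ p q β → windowSeq p q β k₋₁ ≡ q
  windowSeq-last p q β with r <? r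
  ... | yes r<r = ⊥-elim (<-irrefl refl r<r)
  ... | no _ = refl

  window : Fin N → Fin N → ℕ → Subset N
  window p q β = toSub (applyUpTo (windowSeq p q β) k)

  data WindowVertex (p q : Fin N) (β : ℕ) (y : Fin N) : Set where
    first : y ≡ p → WindowVertex p q β y
    last : y ≡ q → WindowVertex p q β y
    inner : ∀ {s} → s < r → y ≡ x (β + s) → WindowVertex p q β y

  ∈-window⁻ : ∀ {p q β y} → y ∈ₗ applyUpTo (windowSeq p q β) k → WindowVertex p q β y
  ∈-window⁻ {p} {q} {β} y∈ with ∈-applyUpTo⁻ (windowSeq p q β) y∈
  ... | zero , _ , y≡ = first y≡
  ... | suc s , s≤s s<k₋₁ , y≡ with m≤n⇒m<n∨m≡n (≤-pred s<k₋₁)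
  ...   | inj₁ s<r = inner s<r (trans y≡ (windowSeq-inner p q β s<r))
  ...   | inj₂ refl = last (trans y≡ (windowSeq-last p q β))

  ∈-window⁺ : ∀ {p q β y} → WindowVertex p q β y → y ∈ₗ applyUpTo (windowSeq p q β) k
  ∈-window⁺ {p} {q} {β} (first refl) = ∈-applyUpTo⁺ (windowSeq p q β) (s≤s z≤n)
  ∈-window⁺ {p} {q} {β} (last refl) =
    subst (_∈ₗ applyUpTo (windowSeq p q β) k) (windowSeq-last p q β) (∈-applyUpTo⁺ (windowSeq p q β) ≤-refl)
  ∈-window⁺ {p} {q} {β} (inner s<r refl) =
    subst (_∈ₗ applyUpTo (windowSeq p q β) k) (windowSeq-inner p q β s<r) (∈-applyUpTo⁺ (windowSeq p q β) (s≤s (m≤n⇒m≤1+n s<r)))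

  window-comm : ∀ p q β → window p q β ≡ window q p β
  window-comm p q β = toSub-cong (∈-window⁺ ∘ flip ∘ ∈-window⁻) (∈-window⁺ ∘ flip ∘ ∈-window⁻)
    where
    flip : ∀ {p q y} → WindowVertex p q β y → WindowVertex q p β y
    flip (first y≡) = last y≡
    flip (last y≡) = first y≡
    flip (inner s<r y≡) = inner s<r y≡

  window-periodic : ∀ p q β → window p q (β + period) ≡ window p q β
  window-periodic p q β = cong toSub (applyUpTo-cong k same)
    where
    same : ∀ {t} → t < k → windowSeq p q (β + period) t ≡ windowSeq p q β t
    same {zero} _ = refl
    same {suc s} (s≤s s≤k₋₁) with m≤n⇒m<n∨m≡n (≤-pred s≤k₋₁)
    ... | inj₂ refl = trans (windowSeq-last p q _) (sym (windowSeq-last p q β))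
    ... | inj₁ s<r = trans (windowSeq-inner p q _ s<r)
                           (trans (cong x +-assoc-comm) (trans (x-periodic (β + s)) (sym (windowSeq-inner p q β s<r))))
      where
      +-assoc-comm : β + period + s ≡ β + s + period
      +-assoc-comm = solve 3 (λ b p s → b :+ p :+ s := b :+ s :+ p) refl β period s

  private
    offset-with-parity : ∀ β b → b ≤ 1 → ∃[ e ] (e ≤ 1 × (β + e) % 2 ≡ b)
    offset-with-parity β b b≤1 with %2≡0⊎%2≡1 β | b | b≤1
    ... | inj₁ even | zero | _ = 0 , z≤n , trans (cong (_% 2) (+-identityʳ β)) even
    ... | inj₂ odd | suc zero | _ = 0 , z≤n , trans (cong (_% 2) (+-identityʳ β)) odd
    ... | inj₁ even | suc zero | _ = 1 , s≤s z≤n , trans (%-distribˡ-+ β 1 2) (cong (λ z → (z + 1) % 2) even)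
    ... | inj₂ odd | zero | _ = 1 , s≤s z≤n , trans (%-distribˡ-+ β 1 2) (cong (λ z → (z + 1) % 2) odd)
    ... | _ | suc (suc _) | s≤s ()

    step-parity : ∀ β e u → (β + (e + u * 2)) % 2 ≡ (β + e) % 2
    step-parity β e u = trans (cong (_% 2) (sym (+-assoc β e (u * 2)))) ([m+kn]%n≡m%n (β + e) u 2)

    3≤∣∩∣ : ∀ {S I : Subset N} β {e} → e ≤ 1 → (∀ {s} → s < r → x (β + s) ∈ S) →
            (∀ u → x (β + (e + u * 2)) ∈ I) → 3 ≤ ∣ S ∩ I ∣
    3≤∣∩∣ β {e} e≤1 ⊆S ⊆I = 3≤∣p∣ (both 0 z≤n) (both 1 (s≤s z≤n)) (both 2 ≤-refl)
      (distinct 0 1 z≤n (s≤s z≤n) λ ()) (distinct 0 2 z≤n ≤-refl λ ()) (distinct 1 2 (s≤s z≤n) ≤-refl λ ())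
      where
      e+2u<6 : ∀ {u} → u ≤ 2 → e + u * 2 < 6
      e+2u<6 u≤2 = +-mono-≤ (s≤s e≤1) (*-monoˡ-≤ 2 u≤2)
      both : ∀ u → u ≤ 2 → x (β + (e + u * 2)) ∈ _ ∩ _
      both u u≤2 = Subsetₚ.x∈p∩q⁺ (⊆S (<-≤-trans (e+2u<6 u≤2) 6≤r) , ⊆I u)
      distinct : ∀ u u′ → u ≤ 2 → u′ ≤ 2 → u ≢ u′ → x (β + (e + u * 2)) ≢ x (β + (e + u′ * 2))
      distinct u u′ u≤2 u′≤2 u≢u′ eq = u≢u′ (*-cancelʳ-≡ u u′ 2 (+-cancelˡ-≡ e _ _
        (x-window-injective β (<-≤-trans (e+2u<6 u≤2) 6≤period) (<-≤-trans (e+2u<6 u′≤2) 6≤period) eq)))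

  -- Among r ≥ 6 consecutive terms of x, three have even index (in e_i) and three odd index (in f_j).
  window-meets-inner : ∀ {S : Subset N} β → (∀ {s} → s < r → x (β + s) ∈ S) →
                       3 ≤ ∣ S ∩ cycInner k φ₁ i ∣ × 3 ≤ ∣ S ∩ cycInner k φ₂ j ∣
  window-meets-inner β ⊆S with offset-with-parity β 0 z≤n | offset-with-parity β 1 ≤-refl
  ... | e₀ , e₀≤1 , even | e₁ , e₁≤1 , odd = 3≤∣∩∣ β e₀≤1 ⊆S inner₁ , 3≤∣∩∣ β e₁≤1 ⊆S inner₂
    where
    inner₁ : ∀ u → x (β + (e₀ + u * 2)) ∈ cycInner k φ₁ i
    inner₁ u with x-even (β + (e₀ + u * 2)) (trans (step-parity β e₀ u) even)
    ... | q , q<r , x≡ = subst (_∈ cycInner k φ₁ i) (sym x≡) (V₁∈inner q q<r)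
    inner₂ : ∀ u → x (β + (e₁ + u * 2)) ∈ cycInner k φ₂ j
    inner₂ u with x-odd (β + (e₁ + u * 2)) (trans (step-parity β e₁ u) odd)
    ... | q , q<r , x≡ = subst (_∈ cycInner k φ₂ j) (sym x≡) (V₂∈inner q q<r)

record Endpoints {N : ℕ} (P : TwoCycles N) : Set where
  open TwoCycles P
  field
    1≤m₁ : 1 ≤ m₁
    1≤m₂ : 1 ≤ m₂
    v′ v″ u′ u″ : Fin N
    a′ a″ b′ b″ : ℕ
    1≤a′ : 1 ≤ a′
    a′≤k₋₁ : a′ ≤ suc r
    v′≡ : v′ ≡ Interleaving.V₁ P (m₁ * suc r + a′)
    a″≤r : a″ ≤ r
    v″≡ : v″ ≡ Interleaving.V₁ P (suc r + a″)
    1≤b′ : 1 ≤ b′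
    b′≤k₋₁ : b′ ≤ suc r
    u′≡ : u′ ≡ Interleaving.V₂ P (m₂ * suc r + b′)
    b″≤r : b″ ≤ r
    u″≡ : u″ ≡ Interleaving.V₂ P (suc r + b″)
    v′≢v″ : v′ ≢ v″
    u′≢u″ : u′ ≢ u″
    no-blue-cycle : ¬ (∃[ φ ] IsLooseCycle c blue (suc (suc r)) (suc m₁ + suc m₂) φ)

module RedPaths {N : ℕ} (P : TwoCycles N) (Q : Endpoints P) where
  open TwoCycles P
  open Endpoints Q
  open Interleaving P

  Allowed : Subset N
  Allowed = cycInner k φ₁ i ∪ cycInner k φ₂ j ∪ (⁅ v′ ⁆ ∪ ⁅ v″ ⁆ ∪ ⁅ u′ ⁆ ∪ ⁅ u″ ⁆)

  Goal : Set
  Goal = ∃[ ψ ] (IsLoosePath c red k 2 ψ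
      × image ψ ⊆ Allowed
      × ((m : Fin 2) →
           (3 ≤ ∣ pathEdge k ψ (toℕ m) ∩ cycInner k φ₁ i ∣)
         × (3 ≤ ∣ pathEdge k ψ (toℕ m) ∩ cycInner k φ₂ j ∣)))

  len : ℕ
  len = k₋₁ * 2 + 1

  goal-from-windows : (S : ℕ → Fin N) (p q p′ q′ : Fin N) (β β′ : ℕ) →
    (∀ o o′ → o < len → o′ < len → S o ≡ S o′ → o ≡ o′) →
    toSub (applyUpTo (λ t → S (0 * k₋₁ + t)) k) ≡ window p q β →
    toSub (applyUpTo (λ t → S (1 * k₋₁ + t)) k) ≡ window p′ q′ β′ →
    c (window p q β) ≡ red → c (window p′ q′ β′) ≡ red →
    (∀ o → o < len → S o ∈ Allowed) → Goal
  goal-from-windows S p q p′ q′ β β′ S-inj first≡ second≡ first-red second-red S⊆Allowed =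
    path , (path-injective S-inj , red-edges) , image-path {P = _∈ Allowed} S⊆Allowed , meets-inner
    where
    open SequenceAsPath k₋₁ S
    path-edge₀ : pathEdge k path 0 ≡ window p q β
    path-edge₀ = trans (pathEdge-path 0 (≤-<-trans (m≤m*n k₋₁ 2) (m<m+n (k₋₁ * 2) (s≤s z≤n)))) first≡
    path-edge₁ : pathEdge k path 1 ≡ window p′ q′ β′
    path-edge₁ = trans (pathEdge-path 1 (≤-<-trans (≤-reflexive (solve 1 (λ κ → con 1 :* κ :+ κ := κ :* con 2) refl k₋₁))
                                               (m<m+n (k₋₁ * 2) (s≤s z≤n)))) second≡
    red-edges : ∀ (m : Fin 2) → c (pathEdge k path (toℕ m)) ≡ red
    red-edges fzero = trans (cong c path-edge₀) first-red
    red-edges (fsuc fzero) = trans (cong c path-edge₁) second-red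
    x∈window : ∀ p q β {s} → s < r → x (β + s) ∈ window p q β
    x∈window p q β s<r = ∈-toSub⁺ (∈-window⁺ (inner s<r refl))
    meets-inner : (m : Fin 2) → 3 ≤ ∣ pathEdge k path (toℕ m) ∩ cycInner k φ₁ i ∣
                              × 3 ≤ ∣ pathEdge k path (toℕ m) ∩ cycInner k φ₂ j ∣
    meets-inner fzero rewrite path-edge₀ = window-meets-inner β (x∈window p q β)
    meets-inner (fsuc fzero) rewrite path-edge₁ = window-meets-inner β′ (x∈window p′ q′ β′)

  private
    ∪ˡ : ∀ {y : Fin N} {p q} → y ∈ p → y ∈ p ∪ q
    ∪ˡ y∈ = Subsetₚ.x∈p∪q⁺ (inj₁ y∈)
    ∪ʳ : ∀ {y : Fin N} {p q} → y ∈ q → y ∈ p ∪ q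
    ∪ʳ y∈ = Subsetₚ.x∈p∪q⁺ (inj₂ y∈)

  v′∈Allowed : v′ ∈ Allowed
  v′∈Allowed = ∪ʳ (∪ʳ (∪ˡ (Subsetₚ.x∈⁅x⁆ v′)))
  v″∈Allowed : v″ ∈ Allowed
  v″∈Allowed = ∪ʳ (∪ʳ (∪ʳ (∪ˡ (Subsetₚ.x∈⁅x⁆ v″))))
  u′∈Allowed : u′ ∈ Allowed
  u′∈Allowed = ∪ʳ (∪ʳ (∪ʳ (∪ʳ (∪ˡ (Subsetₚ.x∈⁅x⁆ u′)))))
  u″∈Allowed : u″ ∈ Allowed
  u″∈Allowed = ∪ʳ (∪ʳ (∪ʳ (∪ʳ (∪ʳ (Subsetₚ.x∈⁅x⁆ u″)))))
  x∈Allowed : ∀ y → x y ∈ Allowed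
  x∈Allowed y with x∈inner y
  ... | inj₁ x∈ = ∪ˡ x∈
  ... | inj₂ x∈ = ∪ʳ (∪ˡ x∈)

  private
    k₋₁≤m*k₋₁ : ∀ {m} → 1 ≤ m → k₋₁ ≤ m * k₋₁
    k₋₁≤m*k₋₁ {m} 1≤m = ≤-trans (≤-reflexive (sym (*-identityˡ k₋₁))) (*-monoˡ-≤ k₋₁ 1≤m)
    last-edge≤L : ∀ m {a} → a ≤ k₋₁ → m * k₋₁ + a ≤ k₋₁ * suc m
    last-edge≤L m a≤k₋₁ = ≤-trans (+-monoʳ-≤ (m * k₋₁) a≤k₋₁) (≤-reflexive (trans (+-comm (m * k₋₁) k₋₁) (*-comm (suc m) k₋₁)))
    second-edge≤L : ∀ m {a} → 1 ≤ m → a ≤ r → k₋₁ + a ≤ k₋₁ * suc m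
    second-edge≤L m 1≤m a≤r = ≤-trans (+-monoʳ-≤ k₋₁ (≤-trans a≤r (n≤1+n r)))
      (≤-trans (≤-reflexive (solve 1 (λ κ → κ :+ κ := κ :* con 2) refl k₋₁)) (*-monoʳ-≤ k₋₁ (s≤s 1≤m)))

  x≢v′ : ∀ y → x y ≢ v′
  x≢v′ y eq = x≢V₁ y (≤-trans (k₋₁≤m*k₋₁ 1≤m₁) (m≤m+n _ a′)) (last-edge≤L m₁ a′≤k₋₁) (trans eq v′≡)
  x≢v″ : ∀ y → x y ≢ v″
  x≢v″ y eq = x≢V₁ y (m≤m+n k₋₁ a″) (second-edge≤L m₁ 1≤m₁ a″≤r) (trans eq v″≡)
  x≢u′ : ∀ y → x y ≢ u′
  x≢u′ y eq = x≢V₂ y (≤-trans (k₋₁≤m*k₋₁ 1≤m₂) (m≤m+n _ b′)) (last-edge≤L m₂ b′≤k₋₁) (trans eq u′≡)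
  x≢u″ : ∀ y → x y ≢ u″
  x≢u″ y eq = x≢V₂ y (m≤m+n k₋₁ b″) (second-edge≤L m₂ 1≤m₂ b″≤r) (trans eq u″≡)

  v′≢u′ : v′ ≢ u′
  v′≢u′ eq = V₁≢V₂ _ _ (trans (sym v′≡) (trans eq u′≡))
  v′≢u″ : v′ ≢ u″
  v′≢u″ eq = V₁≢V₂ _ _ (trans (sym v′≡) (trans eq u″≡))
  v″≢u′ : v″ ≢ u′
  v″≢u′ eq = V₁≢V₂ _ _ (trans (sym v″≡) (trans eq u′≡))
  v″≢u″ : v″ ≢ u″
  v″≢u″ eq = V₁≢V₂ _ _ (trans (sym v″≡) (trans eq u″≡))

  -- Path vertices are described symbolically; injectivity then follows from a left inverse `position`.
  data Code : Set where
    vertex : Fin N → Code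
    xAt : ℕ → Code

  decode : ℕ → Code → Fin N
  decode α (vertex v) = v
  decode α (xAt g) = x (α + g)

  Valid : Code → Set
  Valid (vertex v) = (∀ y → x y ≢ v) × v ∈ Allowed
  Valid (xAt g) = g < period

  decode-injective : ∀ α {a b} → Valid a → Valid b → decode α a ≡ decode α b → a ≡ b
  decode-injective α {vertex v} {vertex w} _ _ eq = cong vertex eq
  decode-injective α {vertex v} {xAt g} (x≢v , _) _ eq = ⊥-elim (x≢v (α + g) (sym eq))
  decode-injective α {xAt g} {vertex w} _ (x≢w , _) eq = ⊥-elim (x≢w (α + g) eq)
  decode-injective α {xAt g} {xAt g′} g< g′< eq = cong xAt (x-window-injective α g< g′< eq)

  decode∈Allowed : ∀ α {a} → Valid a → decode α a ∈ Allowed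
  decode∈Allowed α {vertex v} (_ , v∈) = v∈
  decode∈Allowed α {xAt g} _ = x∈Allowed (α + g)

  decode-code-injective : ∀ α (code : ℕ → Code) (position : Code → ℕ) →
    (∀ {o} → o < len → position (code o) ≡ o) → (∀ {o} → o < len → Valid (code o)) →
    ∀ o o′ → o < len → o′ < len → decode α (code o) ≡ decode α (code o′) → o ≡ o′
  decode-code-injective α code position left-inverse valid o o′ o< o′< eq =
    trans (sym (left-inverse o<)) (trans (cong position (decode-injective α (valid o<) (valid o′<) eq)) (left-inverse o′<))

  windowCode : Fin N → Fin N → ℕ → ℕ → Code
  windowCode p q b zero = vertex p
  windowCode p q b (suc s) with s <? r
  ... | yes _ = xAt (b + s)
  ... | no _ = vertex q

  decode-windowCode : ∀ α p q b t → decode α (windowCode p q b t) ≡ windowSeq p q (α + b) t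
  decode-windowCode α p q b zero = refl
  decode-windowCode α p q b (suc s) with s <? r
  ... | yes _ = cong x (sym (+-assoc α b s))
  ... | no _ = refl

  windowCode-last : ∀ p q b → windowCode p q b k₋₁ ≡ vertex q
  windowCode-last p q b with r <? r
  ... | yes r<r = ⊥-elim (<-irrefl refl r<r)
  ... | no _ = refl

  windowCode-valid : ∀ p q b t → Valid (vertex p) → Valid (vertex q) → b + r ≤ period → Valid (windowCode p q b t)
  windowCode-valid p q b zero p-valid q-valid _ = p-valid
  windowCode-valid p q b (suc s) p-valid q-valid b+r≤ with s <? r
  ... | yes s<r = <-≤-trans (+-monoʳ-< b s<r) b+r≤
  ... | no _ = q-valid

  private
    o≤2k₋₁ : ∀ {o} → o < len → o ≤ k₋₁ + k₋₁
    o≤2k₋₁ o<len = ≤-pred (≤-trans o<len (≤-reflexive (trans (+-comm (k₋₁ * 2) 1)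
      (cong suc (solve 1 (λ κ → κ :* con 2 := κ :+ κ) refl k₋₁)))))

  module SharedEndpoint (p₁ p₂ p₃ : Fin N) (p₁-valid : Valid (vertex p₁)) (p₂-valid : Valid (vertex p₂))
                        (p₃-valid : Valid (vertex p₃)) (p₁≢p₂ : p₁ ≢ p₂) (p₁≢p₃ : p₁ ≢ p₃) (p₂≢p₃ : p₂ ≢ p₃) (α : ℕ) where

    code : ℕ → Code
    code o with o ≤? k₋₁
    ... | yes _ = windowCode p₁ p₂ 0 o
    ... | no _ = windowCode p₂ p₃ r (o ∸ k₋₁)

    position : Code → ℕ
    position (vertex v) with v ≟ᶠ p₁
    ... | yes _ = 0
    ... | no _ with v ≟ᶠ p₂
    ...   | yes _ = k₋₁
    ...   | no _ = k₋₁ + k₋₁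
    position (xAt g) with g <? r
    ... | yes _ = suc g
    ... | no _ = suc (suc g)

    position-p₁ : position (vertex p₁) ≡ 0
    position-p₁ with p₁ ≟ᶠ p₁
    ... | yes _ = refl
    ... | no p₁≢p₁ = ⊥-elim (p₁≢p₁ refl)
    position-p₂ : position (vertex p₂) ≡ k₋₁
    position-p₂ with p₂ ≟ᶠ p₁
    ... | yes p₂≡p₁ = ⊥-elim (p₁≢p₂ (sym p₂≡p₁))
    ... | no _ with p₂ ≟ᶠ p₂
    ...   | yes _ = refl
    ...   | no p₂≢p₂ = ⊥-elim (p₂≢p₂ refl)
    position-p₃ : position (vertex p₃) ≡ k₋₁ + k₋₁
    position-p₃ with p₃ ≟ᶠ p₁
    ... | yes p₃≡p₁ = ⊥-elim (p₁≢p₃ (sym p₃≡p₁))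
    ... | no _ with p₃ ≟ᶠ p₂
    ...   | yes p₃≡p₂ = ⊥-elim (p₂≢p₃ (sym p₃≡p₂))
    ...   | no _ = refl

    position-code : ∀ {o} → o < len → position (code o) ≡ o
    position-code {o} o<len with o ≤? k₋₁
    position-code {zero} _ | yes _ = position-p₁
    position-code {suc s} _ | yes (s≤s s≤r) with s <? r
    ... | yes s<r with s <? r
    ...   | yes _ = refl
    ...   | no s≮r = ⊥-elim (s≮r s<r)
    position-code {suc s} _ | yes (s≤s s≤r) | no s≮r = trans position-p₂ (cong suc (sym (≤∧≮⇒≡ s≤r s≮r)))
    position-code {o} o<len | no o≰k₋₁ = second (o ∸ k₋₁) (m+[n∸m]≡n (<⇒≤ (≰⇒> o≰k₋₁))) (m<n⇒0<n∸m (≰⇒> o≰k₋₁))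
      where
      second : ∀ d → k₋₁ + d ≡ o → 0 < d → position (windowCode p₂ p₃ r d) ≡ o
      second (suc s) eq _ with s <? r
      ... | yes s<r with r + s <? r
      ...   | yes r+s<r = ⊥-elim (<-irrefl refl (≤-<-trans (m≤m+n r s) r+s<r))
      ...   | no _ = trans (cong suc (sym (+-suc r s))) eq
      second (suc s) eq _ | no s≮r = trans position-p₃ (trans (cong (λ z → k₋₁ + suc z) (sym s≡r)) eq)
        where
        s≡r : s ≡ r
        s≡r = ≤∧≮⇒≡ (≤-pred (+-cancelˡ-≤ k₋₁ (suc s) k₋₁ (subst (_≤ k₋₁ + k₋₁) (sym eq) (o≤2k₋₁ o<len)))) s≮r

    code-valid : ∀ {o} → o < len → Valid (code o)
    code-valid {o} _ with o ≤? k₋₁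
    ... | yes _ = windowCode-valid p₁ p₂ 0 o p₁-valid p₂-valid (m≤m*n r 2)
    ... | no _ = windowCode-valid p₂ p₃ r (o ∸ k₋₁) p₂-valid p₃-valid (≤-reflexive r+r≡period)

    S : ℕ → Fin N
    S o = decode α (code o)

    first-window : ∀ {t} → t < k → S (0 * k₋₁ + t) ≡ windowSeq p₁ p₂ (α + 0) t
    first-window {t} (s≤s t≤k₋₁) with t ≤? k₋₁
    ... | yes _ = decode-windowCode α p₁ p₂ 0 t
    ... | no t≰k₋₁ = ⊥-elim (t≰k₋₁ t≤k₋₁)

    second-window : ∀ {t} → t < k → S (1 * k₋₁ + t) ≡ windowSeq p₂ p₃ (α + r) t
    second-window {t} (s≤s t≤k₋₁) = trans (cong (λ z → S (z + t)) (*-identityˡ k₋₁)) (shifted t)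
      where
      shifted : ∀ t → S (k₋₁ + t) ≡ windowSeq p₂ p₃ (α + r) t
      shifted zero with k₋₁ + 0 ≤? k₋₁
      ... | yes _ = cong (decode α) (trans (cong (windowCode p₁ p₂ 0) (+-identityʳ k₋₁)) (windowCode-last p₁ p₂ 0))
      ... | no nle = ⊥-elim (nle (≤-reflexive (+-identityʳ k₋₁)))
      shifted (suc t) with k₋₁ + suc t ≤? k₋₁
      ... | yes le = ⊥-elim (<-irrefl refl (<-≤-trans (m<m+n k₋₁ (s≤s z≤n)) le))
      ... | no _ = trans (cong (λ z → decode α (windowCode p₂ p₃ r z)) (m+n∸m≡n k₋₁ (suc t)))
                         (decode-windowCode α p₂ p₃ r (suc t))

    path : c (window p₁ p₂ α) ≡ red → c (window p₂ p₃ (α + r)) ≡ red → Goal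
    path first-red second-red = goal-from-windows S p₁ p₂ p₂ p₃ (α + 0) (α + r)
      (decode-code-injective α code position position-code code-valid)
      (cong toSub (applyUpTo-cong k first-window)) (cong toSub (applyUpTo-cong k second-window))
      (subst (λ z → c (window p₁ p₂ z) ≡ red) (sym (+-identityʳ α)) first-red) second-red
      (λ o o<len → decode∈Allowed α (code-valid o<len))

  v′-valid : Valid (vertex v′)
  v′-valid = x≢v′ , v′∈Allowed
  v″-valid : Valid (vertex v″)
  v″-valid = x≢v″ , v″∈Allowed
  u′-valid : Valid (vertex u′)
  u′-valid = x≢u′ , u′∈Allowed
  u″-valid : Valid (vertex u″)
  u″-valid = x≢u″ , u″∈Allowed

  -- The two windows of `path` share the vertex x α = x (α + 2r).
  module SharedInnerVertex (α : ℕ) where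

    firstCode : ℕ → Code
    firstCode zero = vertex v″
    firstCode (suc zero) = vertex u′
    firstCode (suc (suc s)) = xAt (r + s)

    secondCode : ℕ → Code
    secondCode zero = vertex v″
    secondCode (suc t) with suc t <? r
    ... | yes _ = xAt t
    ... | no _ with t <? r
    ...   | yes _ = vertex v′
    ...   | no _ = vertex u″

    secondCode-inner : ∀ t → suc t < r → secondCode (suc t) ≡ xAt t
    secondCode-inner t 1+t<r with suc t <? r
    ... | yes _ = refl
    ... | no nlt = ⊥-elim (nlt 1+t<r)
    secondCode-v′ : ∀ t → suc t ≡ r → secondCode (suc t) ≡ vertex v′
    secondCode-v′ t 1+t≡r with suc t <? r
    ... | yes 1+t<r = ⊥-elim (<-irrefl 1+t≡r 1+t<r)
    ... | no _ with t <? r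
    ...   | yes _ = refl
    ...   | no nlt = ⊥-elim (nlt (≤-reflexive 1+t≡r))
    secondCode-u″ : secondCode k₋₁ ≡ vertex u″
    secondCode-u″ with k₋₁ <? r
    ... | yes k₋₁<r = ⊥-elim (<-irrefl refl (<-trans k₋₁<r (n<1+n r)))
    ... | no _ with r <? r
    ...   | yes r<r = ⊥-elim (<-irrefl refl r<r)
    ...   | no _ = refl

    code : ℕ → Code
    code o with o ≤? k₋₁
    ... | yes _ = firstCode o
    ... | no _ = secondCode (o ∸ k₋₁)

    code-first : ∀ {o} → o ≤ k₋₁ → code o ≡ firstCode o
    code-first {o} o≤k₋₁ with o ≤? k₋₁
    ... | yes _ = refl
    ... | no o≰k₋₁ = ⊥-elim (o≰k₋₁ o≤k₋₁)
    code-second : ∀ {t} → 1 ≤ t → code (k₋₁ + t) ≡ secondCode t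
    code-second {t} 1≤t with k₋₁ + t ≤? k₋₁
    ... | yes le = ⊥-elim (<-irrefl refl (<-≤-trans (m<m+n k₋₁ 1≤t) le))
    ... | no _ = cong secondCode (m+n∸m≡n k₋₁ t)

    position : Code → ℕ
    position (vertex v) with v ≟ᶠ v″
    ... | yes _ = 0
    ... | no _ with v ≟ᶠ u′
    ...   | yes _ = 1
    ...   | no _ with v ≟ᶠ v′
    ...     | yes _ = k₋₁ + r
    ...     | no _ = k₋₁ + k₋₁
    position (xAt g) with g <? r
    ... | yes _ = k₋₁ + suc g
    ... | no _ = suc (suc (g ∸ r))

    position-v″ : position (vertex v″) ≡ 0
    position-v″ with v″ ≟ᶠ v″
    ... | yes _ = refl
    ... | no neq = ⊥-elim (neq refl)
    position-u′ : position (vertex u′) ≡ 1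
    position-u′ with u′ ≟ᶠ v″
    ... | yes eq = ⊥-elim (v″≢u′ (sym eq))
    ... | no _ with u′ ≟ᶠ u′
    ...   | yes _ = refl
    ...   | no neq = ⊥-elim (neq refl)
    position-v′ : position (vertex v′) ≡ k₋₁ + r
    position-v′ with v′ ≟ᶠ v″
    ... | yes eq = ⊥-elim (v′≢v″ eq)
    ... | no _ with v′ ≟ᶠ u′
    ...   | yes eq = ⊥-elim (v′≢u′ eq)
    ...   | no _ with v′ ≟ᶠ v′
    ...     | yes _ = refl
    ...     | no neq = ⊥-elim (neq refl)
    position-u″ : position (vertex u″) ≡ k₋₁ + k₋₁
    position-u″ with u″ ≟ᶠ v″
    ... | yes eq = ⊥-elim (v″≢u″ (sym eq))
    ... | no _ with u″ ≟ᶠ u′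
    ...   | yes eq = ⊥-elim (u′≢u″ (sym eq))
    ...   | no _ with u″ ≟ᶠ v′
    ...     | yes eq = ⊥-elim (v′≢u″ (sym eq))
    ...     | no _ = refl

    position-code : ∀ {o} → o < len → position (code o) ≡ o
    position-code {o} o<len with o ≤? k₋₁
    position-code {zero} _ | yes _ = position-v″
    position-code {suc zero} _ | yes _ = position-u′
    position-code {suc (suc s)} _ | yes _ with r + s <? r
    ... | yes r+s<r = ⊥-elim (<-irrefl refl (≤-<-trans (m≤m+n r s) r+s<r))
    ... | no _ = cong (λ z → suc (suc z)) (m+n∸m≡n r s)
    position-code {o} o<len | no o≰k₋₁ = trans (cong position (sym (code-second 1≤d)))
      (second (o ∸ k₋₁) o≡ 1≤d (+-cancelˡ-≤ k₋₁ (o ∸ k₋₁) k₋₁ (subst (_≤ k₋₁ + k₋₁) (sym o≡) (o≤2k₋₁ o<len))))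
      where
      o≡ : k₋₁ + (o ∸ k₋₁) ≡ o
      o≡ = m+[n∸m]≡n (<⇒≤ (≰⇒> o≰k₋₁))
      1≤d : 1 ≤ o ∸ k₋₁
      1≤d = m<n⇒0<n∸m (≰⇒> o≰k₋₁)
      second : ∀ d → k₋₁ + d ≡ o → 1 ≤ d → d ≤ k₋₁ → position (code (k₋₁ + d)) ≡ o
      second (suc t) eq _ d≤ rewrite code-second {suc t} (s≤s z≤n) with suc t <? r
      ... | yes 1+t<r with t <? r
      ...   | yes _ = eq
      ...   | no t≮r = ⊥-elim (t≮r (<-trans (n<1+n t) 1+t<r))
      second (suc t) eq _ d≤ | no 1+t≮r with t <? r
      ...   | yes t<r = trans position-v′ (trans (cong (k₋₁ +_) (sym (≤∧≮⇒≡ t<r 1+t≮r))) eq)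
      ...   | no t≮r = trans position-u″ (trans (cong (λ z → k₋₁ + suc z) (sym (≤∧≮⇒≡ (≤-pred d≤) t≮r))) eq)

    code-valid : ∀ {o} → o < len → Valid (code o)
    code-valid {o} _ with o ≤? k₋₁
    code-valid {zero} _ | yes _ = v″-valid
    code-valid {suc zero} _ | yes _ = u′-valid
    code-valid {suc (suc s)} _ | yes (s≤s s<r) =
      ≤-trans (≤-reflexive (sym (+-suc r s))) (≤-trans (+-monoʳ-≤ r s<r) (≤-reflexive r+r≡period))
    code-valid {o} _ | no _ = second (o ∸ k₋₁)
      where
      second : ∀ d → Valid (secondCode d)
      second zero = v″-valid
      second (suc t) with suc t <? r
      ... | yes 1+t<r = <-≤-trans (<-trans (n<1+n t) 1+t<r) (m≤m*n r 2)
      ... | no _ with t <? r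
      ...   | yes _ = v′-valid
      ...   | no _ = u″-valid

    S : ℕ → Fin N
    S o = decode (suc α) (code o)

    S-first : ∀ {o} → o ≤ k₋₁ → S o ≡ decode (suc α) (firstCode o)
    S-first o≤k₋₁ = cong (decode (suc α)) (code-first o≤k₋₁)
    S-second : ∀ {t} → 1 ≤ t → S (k₋₁ + t) ≡ decode (suc α) (secondCode t)
    S-second 1≤t = cong (decode (suc α)) (code-second 1≤t)

    shared-vertex : S k₋₁ ≡ x α
    shared-vertex = trans (S-first ≤-refl) (last-of-first r refl)
      where
      last-of-first : ∀ n → n ≡ r → decode (suc α) (firstCode (suc n)) ≡ x α
      last-of-first zero 0≡r = ⊥-elim (<-irrefl 0≡r (<-≤-trans (s≤s z≤n) 6≤r))
      last-of-first (suc s) 1+s≡r = trans (cong x (begin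
        suc α + (r + s)    ≡⟨ sym (+-suc α (r + s)) ⟩
        α + suc (r + s)    ≡⟨ cong (α +_) (sym (+-suc r s)) ⟩
        α + (r + suc s)    ≡⟨ cong (λ z → α + (r + z)) 1+s≡r ⟩
        α + (r + r)        ≡⟨ cong (α +_) r+r≡period ⟩
        α + period         ∎)) (x-periodic α)
        where open ≡-Reasoning

    first-edge : toSub (applyUpTo (λ t → S (0 * k₋₁ + t)) k) ≡ window v″ u′ (suc α + r)
    first-edge = toSub-cong (∈-window⁺ ∘ forth) (back ∘ ∈-window⁻)
      where
      forth : ∀ {y} → y ∈ₗ applyUpTo (λ t → S (0 * k₋₁ + t)) k → WindowVertex v″ u′ (suc α + r) y
      forth y∈ with ∈-applyUpTo⁻ (λ t → S (0 * k₋₁ + t)) y∈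
      ... | t , s≤s t≤k₋₁ , y≡ with trans y≡ (S-first t≤k₋₁)
      ...   | y≡′ with t | t≤k₋₁
      ...     | zero | _ = first y≡′
      ...     | suc zero | _ = last y≡′
      ...     | suc (suc s) | s≤s s<r = inner s<r (trans y≡′ (cong x (sym (+-assoc (suc α) r s))))
      member : ∀ {t} → t < k → S t ∈ₗ applyUpTo (λ t → S (0 * k₋₁ + t)) k
      member = ∈-applyUpTo⁺ (λ t → S (0 * k₋₁ + t))
      back : ∀ {y} → WindowVertex v″ u′ (suc α + r) y → y ∈ₗ applyUpTo (λ t → S (0 * k₋₁ + t)) k
      back (first refl) = subst (_∈ₗ applyUpTo (λ t → S (0 * k₋₁ + t)) k) (S-first z≤n) (member (s≤s z≤n))
      back (last refl) = subst (_∈ₗ applyUpTo (λ t → S (0 * k₋₁ + t)) k) (S-first (s≤s z≤n)) (member (s≤s (s≤s z≤n)))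
      back (inner {s} s<r refl) = subst (_∈ₗ applyUpTo (λ t → S (0 * k₋₁ + t)) k) (trans (S-first (s≤s s<r)) (cong x (sym (+-assoc (suc α) r s))))
                                        (member (s≤s (s≤s s<r)))

    second-edge : toSub (applyUpTo (λ t → S (1 * k₋₁ + t)) k) ≡ window v′ u″ α
    second-edge = toSub-cong (∈-window⁺ ∘ forth) (back ∘ ∈-window⁻)
      where
      T : ℕ → Fin N
      T t = S (1 * k₋₁ + t)
      T-second : ∀ t → T (suc t) ≡ decode (suc α) (secondCode (suc t))
      T-second t = trans (cong (λ z → S (z + suc t)) (*-identityˡ k₋₁)) (S-second (s≤s z≤n))
      T-shared : T 0 ≡ x (α + 0)
      T-shared = trans (cong S (trans (cong (_+ 0) (*-identityˡ k₋₁)) (+-identityʳ k₋₁)))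
                       (trans shared-vertex (cong x (sym (+-identityʳ α))))
      forth : ∀ {y} → y ∈ₗ applyUpTo T k → WindowVertex v′ u″ α y
      forth y∈ with ∈-applyUpTo⁻ T y∈
      ... | zero , _ , y≡ = inner (<-≤-trans (s≤s z≤n) 6≤r) (trans y≡ T-shared)
      ... | suc t , s≤s t≤k₋₁ , y≡ with trans y≡ (T-second t) | r ≤? suc t
      ...   | y≡′ | no r≰1+t = inner (≰⇒> r≰1+t)
                                 (trans y≡′ (trans (cong (decode (suc α)) (secondCode-inner t (≰⇒> r≰1+t))) (cong x (sym (+-suc α t)))))
      ...   | y≡′ | yes r≤1+t with r ≤? t
      ...     | no r≰t = first (trans y≡′ (cong (decode (suc α)) (secondCode-v′ t (≤-antisym (≰⇒> r≰t) r≤1+t))))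
      ...     | yes r≤t = last (trans y≡′ (cong (decode (suc α))
                                  (trans (cong (secondCode ∘ suc) (≤-antisym (≤-pred t≤k₋₁) r≤t)) secondCode-u″)))
      member : ∀ {t} → t < k → T t ∈ₗ applyUpTo T k
      member = ∈-applyUpTo⁺ T
      r∸1+1≡r : suc (r ∸ 1) ≡ r
      r∸1+1≡r = m+[n∸m]≡n {1} {r} (≤-trans (s≤s z≤n) 6≤r)
      back : ∀ {y} → WindowVertex v′ u″ α y → y ∈ₗ applyUpTo T k
      back (first refl) = subst (_∈ₗ applyUpTo T k) (trans (T-second (r ∸ 1)) (cong (decode (suc α)) (secondCode-v′ (r ∸ 1) r∸1+1≡r)))
                                (member (s≤s (s≤s (≤-trans (n≤1+n _) (≤-reflexive r∸1+1≡r)))))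
      back (last refl) = subst (_∈ₗ applyUpTo T k) (trans (T-second r) (cong (decode (suc α)) secondCode-u″)) (member ≤-refl)
      back (inner {zero} _ refl) = subst (_∈ₗ applyUpTo T k) T-shared (member (s≤s z≤n))
      back (inner {suc s} s<r refl) = subst (_∈ₗ applyUpTo T k)
        (trans (T-second s) (trans (cong (decode (suc α)) (secondCode-inner s s<r)) (cong x (sym (+-suc α s)))))
        (member (s≤s (m≤n⇒m≤1+n (<⇒≤ s<r))))

    path : c (window v″ u′ (suc α + r)) ≡ red → c (window v′ u″ α) ≡ red → Goal
    path first-red second-red = goal-from-windows S v″ u′ v′ u″ (suc α + r) α
      (decode-code-injective (suc α) code position position-code code-valid) first-edge second-edge first-red second-red
      (λ o o<len → decode∈Allowed (suc α) (code-valid o<len))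

module BlueCycles {N : ℕ} (P : TwoCycles N) (Q : Endpoints P) where
  open TwoCycles P
  open Endpoints Q
  open Interleaving P

  -- τ exchanges k₋₁ ↔ start inside the first edge and top ↔ end inside the last edge of the positions
  -- k₋₁ … top of a loose path with m edges: reading the path through τ keeps every edge but moves its ends.
  module Reanchor (m a₀ a₁ : ℕ) (1≤m : 1 ≤ m) (a₀≤r : a₀ ≤ r) (1≤a₁ : 1 ≤ a₁) (a₁≤k₋₁ : a₁ ≤ k₋₁)
                  (start≢end : k₋₁ + a₀ ≢ m * k₋₁ + a₁) where

    top start end : ℕ
    top = k₋₁ + m * k₋₁
    start = k₋₁ + a₀
    end = m * k₋₁ + a₁

    τ : ℕ → ℕ
    τ o = swap k₋₁ start (swap top end o)

    k₋₁≤m*k₋₁ : k₋₁ ≤ m * k₋₁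
    k₋₁≤m*k₋₁ = ≤-trans (≤-reflexive (sym (*-identityˡ k₋₁))) (*-monoˡ-≤ k₋₁ 1≤m)
    k₋₁<top : k₋₁ < top
    k₋₁<top = m<m+n k₋₁ (≤-trans (s≤s z≤n) k₋₁≤m*k₋₁)
    k₋₁<end : k₋₁ < end
    k₋₁<end = ≤-trans (s≤s k₋₁≤m*k₋₁) (≤-trans (≤-reflexive (sym (+-comm (m * k₋₁) 1))) (+-monoʳ-≤ (m * k₋₁) 1≤a₁))
    start<top : start < top
    start<top = +-monoʳ-< k₋₁ (≤-trans (s≤s a₀≤r) k₋₁≤m*k₋₁)
    end≤top : end ≤ top
    end≤top = ≤-trans (+-monoʳ-≤ (m * k₋₁) a₁≤k₋₁) (≤-reflexive (+-comm (m * k₋₁) k₋₁))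
    k₋₁≤start : k₋₁ ≤ start
    k₋₁≤start = m≤m+n k₋₁ a₀

    τ-involutive : ∀ o → τ (τ o) ≡ o
    τ-involutive o = trans
      (cong (swap k₋₁ start) (swap-comm top end k₋₁ start (<⇒≢ k₋₁<top ∘ sym) (<⇒≢ start<top ∘ sym)
                                                          (<⇒≢ k₋₁<end ∘ sym) (start≢end ∘ sym) (swap top end o)))
      (trans (swap-involutive k₋₁ start (swap top end (swap top end o))) (swap-involutive top end o))

    τ-k₋₁ : τ k₋₁ ≡ start
    τ-k₋₁ = trans (cong (swap k₋₁ start) (swap-other top end k₋₁ (<⇒≢ k₋₁<top) (<⇒≢ k₋₁<end))) (swap-a k₋₁ start)

    τ-top : τ top ≡ end
    τ-top = trans (cong (swap k₋₁ start) (swap-a top end)) (swap-other k₋₁ start end (<⇒≢ k₋₁<end ∘ sym) (start≢end ∘ sym))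

    τ-range : ∀ o → InRange k₋₁ top o → InRange k₋₁ top (τ o)
    τ-range o o∈ = swap-preserves-range (both-inside (≤-refl , <⇒≤ k₋₁<top) (k₋₁≤start , <⇒≤ start<top)) (swap top end o)
                     (swap-preserves-range (both-inside (<⇒≤ k₋₁<top , ≤-refl) (<⇒≤ k₋₁<end , end≤top)) o o∈)

    τ-edge : ∀ d → 1 ≤ d → d ≤ m → ∀ o → InRange (d * k₋₁) (d * k₋₁ + k₋₁) o → InRange (d * k₋₁) (d * k₋₁ + k₋₁) (τ o)
    τ-edge d 1≤d d≤m o o∈ = swap-preserves-range first-side (swap top end o) (swap-preserves-range last-side o o∈)
      where
      last-side : SameSide (d * k₋₁) (d * k₋₁ + k₋₁) top end
      last-side with m≤n⇒m<n∨m≡n d≤m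
      ... | inj₂ refl = both-inside (m≤n+m (d * k₋₁) k₋₁ , ≤-reflexive (+-comm k₋₁ (d * k₋₁)))
                                    (m≤m+n _ _ , +-monoʳ-≤ (d * k₋₁) a₁≤k₋₁)
      ... | inj₁ d<m = both-above (<-≤-trans edge-end<end end≤top) edge-end<end
        where
        edge-end<end : d * k₋₁ + k₋₁ < end
        edge-end<end = ≤-trans (s≤s (≤-trans (≤-reflexive (+-comm (d * k₋₁) k₋₁)) (*-monoˡ-≤ k₋₁ d<m)))
                               (≤-trans (≤-reflexive (+-comm 1 (m * k₋₁))) (+-monoʳ-≤ (m * k₋₁) 1≤a₁))
      first-side : SameSide (d * k₋₁) (d * k₋₁ + k₋₁) k₋₁ start
      first-side with m≤n⇒m<n∨m≡n 1≤d
      ... | inj₂ refl = both-inside (≤-reflexive (*-identityˡ k₋₁) , m≤n+m k₋₁ (1 * k₋₁))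
        (≤-trans (≤-reflexive (*-identityˡ k₋₁)) k₋₁≤start ,
         ≤-trans (+-monoʳ-≤ k₋₁ (≤-trans a₀≤r (n≤1+n r))) (≤-reflexive (cong (_+ k₋₁) (sym (*-identityˡ k₋₁)))))
      ... | inj₁ 1<d = both-below (<-≤-trans (m<m+n k₋₁ (s≤s z≤n)) 2k₋₁≤) (<-≤-trans (+-monoʳ-< k₋₁ (s≤s a₀≤r)) 2k₋₁≤)
        where
        2k₋₁≤ : k₋₁ + k₋₁ ≤ d * k₋₁
        2k₋₁≤ = ≤-trans (≤-reflexive (solve 1 (λ κ → κ :+ κ := con 2 :* κ) refl k₋₁)) (*-monoˡ-≤ k₋₁ 1<d)

  OnPath : ℕ → ℕ → Set
  OnPath m = InRange k₋₁ (k₋₁ + m * k₋₁)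

  record Gluing : Set where
    field
      W₁ W₂ : ℕ → Fin N
      a₀ a₁ b₀ b₁ α : ℕ
      W₁-outer : ∀ o → OnPath m₁ o → ∃[ o′ ] (k₋₁ ≤ o′ × o′ ≤ L₁ × W₁ o ≡ V₁ o′)
      W₂-outer : ∀ o → OnPath m₂ o → ∃[ o′ ] (k₋₁ ≤ o′ × o′ ≤ L₂ × W₂ o ≡ V₂ o′)
      W₁-injective : ∀ o o′ → OnPath m₁ o → OnPath m₁ o′ → W₁ o ≡ W₁ o′ → o ≡ o′
      W₂-injective : ∀ o o′ → OnPath m₂ o → OnPath m₂ o′ → W₂ o ≡ W₂ o′ → o ≡ o′
      W₁-blue : ∀ d → 1 ≤ d → d ≤ m₁ → c (toSub (applyUpTo (λ t → W₁ (d * k₋₁ + t)) k)) ≡ blue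
      W₂-blue : ∀ d → 1 ≤ d → d ≤ m₂ → c (toSub (applyUpTo (λ t → W₂ (d * k₋₁ + t)) k)) ≡ blue
      a₀≤r : a₀ ≤ r
      1≤a₁ : 1 ≤ a₁
      a₁≤k₋₁ : a₁ ≤ k₋₁
      b₀≤r : b₀ ≤ r
      1≤b₁ : 1 ≤ b₁
      b₁≤k₋₁ : b₁ ≤ k₋₁
      start≢end₁ : k₋₁ + a₀ ≢ m₁ * k₋₁ + a₁
      start≢end₂ : k₋₁ + b₀ ≢ m₂ * k₋₁ + b₁
      bridge₁-blue : c (window (W₁ (m₁ * k₋₁ + a₁)) (W₂ (k₋₁ + b₀)) α) ≡ blue
      bridge₂-blue : c (window (W₂ (m₂ * k₋₁ + b₁)) (W₁ (k₋₁ + a₀)) (α + r)) ≡ blue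

  -- Cycle positions: W₁ ∘ τ₁ on 0 … B₁, then bridge₁, W₂ ∘ τ₂ on Q₂ … Q₃, and bridge₂.
  module Glue (G : Gluing) where
    open Gluing G
    module R₁ = Reanchor m₁ a₀ a₁ 1≤m₁ a₀≤r 1≤a₁ a₁≤k₋₁ start≢end₁
    module R₂ = Reanchor m₂ b₀ b₁ 1≤m₂ b₀≤r 1≤b₁ b₁≤k₋₁ start≢end₂
    open R₁ using () renaming (τ to τ₁)
    open R₂ using () renaming (τ to τ₂)

    end₁ start₂ end₂ start₁ : Fin N
    end₁ = W₁ (m₁ * k₋₁ + a₁)
    start₂ = W₂ (k₋₁ + b₀)
    end₂ = W₂ (m₂ * k₋₁ + b₁)
    start₁ = W₁ (k₋₁ + a₀)

    B₁ B₂ Q₂ Q₃ L : ℕ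
    B₁ = m₁ * k₋₁
    B₂ = m₂ * k₋₁
    Q₂ = B₁ + k₋₁
    Q₃ = Q₂ + B₂
    L = k₋₁ * (suc m₁ + suc m₂)

    L≡ : L ≡ Q₃ + k₋₁
    L≡ = solve 3 (λ κ a b → κ :* ((con 1 :+ a) :+ (con 1 :+ b)) := ((a :* κ :+ κ) :+ b :* κ) :+ κ) refl k₋₁ m₁ m₂

    data Code : Set where
      on₁ on₂ x-at : ℕ → Code

    decode : Code → Fin N
    decode (on₁ o) = W₁ o
    decode (on₂ o) = W₂ o
    decode (x-at g) = x (α + g)

    Valid : Code → Set
    Valid (on₁ o) = InRange k₋₁ R₁.top o
    Valid (on₂ o) = InRange k₋₁ R₂.top o
    Valid (x-at g) = g < period

    bridge₁ : ℕ → Code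
    bridge₁ zero = on₁ (m₁ * k₋₁ + a₁)
    bridge₁ (suc s) with s <? r
    ... | yes _ = x-at s
    ... | no _ = on₂ (k₋₁ + b₀)

    bridge₂ : ℕ → Code
    bridge₂ zero = on₂ (m₂ * k₋₁ + b₁)
    bridge₂ (suc s) with s <? r
    ... | yes _ = x-at (r + s)
    ... | no _ = on₁ (k₋₁ + a₀)

    code : ℕ → Code
    code p with p ≤? B₁
    ... | yes _ = on₁ (τ₁ (k₋₁ + p))
    ... | no _ with p ≤? Q₂
    ...   | yes _ = bridge₁ (p ∸ B₁)
    ...   | no _ with p ≤? Q₃
    ...     | yes _ = on₂ (τ₂ (k₋₁ + (p ∸ Q₂)))
    ...     | no _ = bridge₂ (p ∸ Q₃)

    position : Code → ℕ
    position (on₁ o) = τ₁ o ∸ k₋₁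
    position (on₂ o) = Q₂ + (τ₂ o ∸ k₋₁)
    position (x-at g) with g <? r
    ... | yes _ = B₁ + suc g
    ... | no _ = Q₃ + suc (g ∸ r)

    S : ℕ → Fin N
    S p = decode (code p)

    W₁≢x : ∀ {o} y → Valid (on₁ o) → W₁ o ≢ x y
    W₁≢x y o∈ eq with W₁-outer _ o∈
    ... | o′ , k₋₁≤o′ , o′≤L₁ , W₁≡ = x≢V₁ y k₋₁≤o′ o′≤L₁ (trans (sym eq) W₁≡)
    W₂≢x : ∀ {o} y → Valid (on₂ o) → W₂ o ≢ x y
    W₂≢x y o∈ eq with W₂-outer _ o∈
    ... | o′ , k₋₁≤o′ , o′≤L₂ , W₂≡ = x≢V₂ y k₋₁≤o′ o′≤L₂ (trans (sym eq) W₂≡)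
    W₁≢W₂ : ∀ {o o′} → Valid (on₁ o) → Valid (on₂ o′) → W₁ o ≢ W₂ o′
    W₁≢W₂ o∈ o′∈ eq with W₁-outer _ o∈ | W₂-outer _ o′∈
    ... | _ , _ , _ , W₁≡ | _ , _ , _ , W₂≡ = V₁≢V₂ _ _ (trans (sym W₁≡) (trans eq W₂≡))

    decode-injective : ∀ {a b} → Valid a → Valid b → decode a ≡ decode b → a ≡ b
    decode-injective {on₁ o} {on₁ o′} va vb eq = cong on₁ (W₁-injective o o′ va vb eq)
    decode-injective {on₁ o} {on₂ o′} va vb eq = ⊥-elim (W₁≢W₂ va vb eq)
    decode-injective {on₁ o} {x-at g} va vb eq = ⊥-elim (W₁≢x _ va eq)
    decode-injective {on₂ o} {on₁ o′} va vb eq = ⊥-elim (W₁≢W₂ vb va (sym eq))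
    decode-injective {on₂ o} {on₂ o′} va vb eq = cong on₂ (W₂-injective o o′ va vb eq)
    decode-injective {on₂ o} {x-at g} va vb eq = ⊥-elim (W₂≢x _ va eq)
    decode-injective {x-at g} {on₁ o} va vb eq = ⊥-elim (W₁≢x _ vb (sym eq))
    decode-injective {x-at g} {on₂ o} va vb eq = ⊥-elim (W₂≢x _ vb (sym eq))
    decode-injective {x-at g} {x-at g′} va vb eq = cong x-at (x-window-injective α va vb eq)

    code-on₁ : ∀ {p} → p ≤ B₁ → code p ≡ on₁ (τ₁ (k₋₁ + p))
    code-on₁ {p} p≤ with p ≤? B₁
    ... | yes _ = refl
    ... | no p≰ = ⊥-elim (p≰ p≤)
    code-bridge₁ : ∀ {p} → B₁ < p → p ≤ Q₂ → code p ≡ bridge₁ (p ∸ B₁)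
    code-bridge₁ {p} B₁<p p≤ with p ≤? B₁
    ... | yes p≤B₁ = ⊥-elim (<⇒≱ B₁<p p≤B₁)
    ... | no _ with p ≤? Q₂
    ...   | yes _ = refl
    ...   | no p≰ = ⊥-elim (p≰ p≤)
    code-on₂ : ∀ {p} → Q₂ < p → p ≤ Q₃ → code p ≡ on₂ (τ₂ (k₋₁ + (p ∸ Q₂)))
    code-on₂ {p} Q₂<p p≤ with p ≤? B₁
    ... | yes p≤B₁ = ⊥-elim (<⇒≱ (≤-trans (s≤s (m≤m+n B₁ k₋₁)) Q₂<p) p≤B₁)
    ... | no _ with p ≤? Q₂
    ...   | yes p≤Q₂ = ⊥-elim (<⇒≱ Q₂<p p≤Q₂)
    ...   | no _ with p ≤? Q₃
    ...     | yes _ = refl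
    ...     | no p≰ = ⊥-elim (p≰ p≤)
    code-bridge₂ : ∀ {p} → Q₃ < p → code p ≡ bridge₂ (p ∸ Q₃)
    code-bridge₂ {p} Q₃<p with p ≤? B₁
    ... | yes p≤B₁ = ⊥-elim (<⇒≱ (≤-trans (s≤s (≤-trans (m≤m+n B₁ k₋₁) (m≤m+n Q₂ B₂))) Q₃<p) p≤B₁)
    ... | no _ with p ≤? Q₂
    ...   | yes p≤Q₂ = ⊥-elim (<⇒≱ (≤-trans (s≤s (m≤m+n Q₂ B₂)) Q₃<p) p≤Q₂)
    ...   | no _ with p ≤? Q₃
    ...     | yes p≤Q₃ = ⊥-elim (<⇒≱ Q₃<p p≤Q₃)
    ...     | no _ = refl

    bridge₁-inner : ∀ {s} → s < r → bridge₁ (suc s) ≡ x-at s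
    bridge₁-inner {s} s<r with s <? r
    ... | yes _ = refl
    ... | no s≮r = ⊥-elim (s≮r s<r)
    bridge₁-last : bridge₁ k₋₁ ≡ on₂ (k₋₁ + b₀)
    bridge₁-last with r <? r
    ... | yes r<r = ⊥-elim (<-irrefl refl r<r)
    ... | no _ = refl
    bridge₂-inner : ∀ {s} → s < r → bridge₂ (suc s) ≡ x-at (r + s)
    bridge₂-inner {s} s<r with s <? r
    ... | yes _ = refl
    ... | no s≮r = ⊥-elim (s≮r s<r)
    bridge₂-last : bridge₂ k₋₁ ≡ on₁ (k₋₁ + a₀)
    bridge₂-last with r <? r
    ... | yes r<r = ⊥-elim (<-irrefl refl r<r)
    ... | no _ = refl

    position-x-low : ∀ {g} → g < r → position (x-at g) ≡ B₁ + suc g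
    position-x-low {g} g<r with g <? r
    ... | yes _ = refl
    ... | no g≮r = ⊥-elim (g≮r g<r)
    position-x-high : ∀ {g} → ¬ g < r → position (x-at g) ≡ Q₃ + suc (g ∸ r)
    position-x-high {g} g≮r with g <? r
    ... | yes g<r = ⊥-elim (g≮r g<r)
    ... | no _ = refl

    τ₂-start : τ₂ (k₋₁ + b₀) ≡ k₋₁
    τ₂-start = trans (cong τ₂ (sym R₂.τ-k₋₁)) (R₂.τ-involutive k₋₁)

    position-code : ∀ {p} → p < L → position (code p) ≡ p
    position-code {p} p<L with B₁ <? p
    ... | no B₁≮p = trans (cong position (code-on₁ (≮⇒≥ B₁≮p)))
                          (trans (cong (_∸ k₋₁) (R₁.τ-involutive (k₋₁ + p))) (m+n∸m≡n k₋₁ p))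
    ... | yes B₁<p with Q₂ <? p
    ...   | no Q₂≮p = trans (cong position (code-bridge₁ B₁<p (≮⇒≥ Q₂≮p)))
                            (on-bridge (p ∸ B₁) (m+[n∸m]≡n (<⇒≤ B₁<p)) (m<n⇒0<n∸m B₁<p))
      where
      on-bridge : ∀ t → B₁ + t ≡ p → 0 < t → position (bridge₁ t) ≡ p
      on-bridge (suc s) eq _ with s <? r
      ... | yes s<r = trans (position-x-low s<r) eq
      ... | no s≮r = begin
        Q₂ + (τ₂ (k₋₁ + b₀) ∸ k₋₁)  ≡⟨ cong (λ z → Q₂ + (z ∸ k₋₁)) τ₂-start ⟩
        Q₂ + (k₋₁ ∸ k₋₁)            ≡⟨ cong (Q₂ +_) (n∸n≡0 k₋₁) ⟩
        Q₂ + 0                      ≡⟨ +-identityʳ Q₂ ⟩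
        B₁ + suc r                  ≡⟨ cong (λ z → B₁ + suc z) (sym s≡r) ⟩
        B₁ + suc s                  ≡⟨ eq ⟩
        p                           ∎
        where
        open ≡-Reasoning
        s≡r : s ≡ r
        s≡r = ≤∧≮⇒≡ (≤-pred (+-cancelˡ-≤ B₁ _ _ (subst (_≤ Q₂) (sym eq) (≮⇒≥ Q₂≮p)))) s≮r
    ...   | yes Q₂<p with Q₃ <? p
    ...     | no Q₃≮p = trans (cong position (code-on₂ Q₂<p (≮⇒≥ Q₃≮p)))
                          (trans (cong (λ z → Q₂ + (z ∸ k₋₁)) (R₂.τ-involutive (k₋₁ + (p ∸ Q₂))))
                            (trans (cong (Q₂ +_) (m+n∸m≡n k₋₁ (p ∸ Q₂))) (m+[n∸m]≡n (<⇒≤ Q₂<p))))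
    ...     | yes Q₃<p = trans (cong position (code-bridge₂ Q₃<p))
                               (on-bridge (p ∸ Q₃) (m+[n∸m]≡n (<⇒≤ Q₃<p)) (m<n⇒0<n∸m Q₃<p))
      where
      on-bridge : ∀ t → Q₃ + t ≡ p → 0 < t → position (bridge₂ t) ≡ p
      on-bridge (suc s) eq _ = trans (cong position (bridge₂-inner s<r))
        (trans (position-x-high (λ r+s<r → <-irrefl refl (≤-<-trans (m≤m+n r s) r+s<r)))
          (trans (cong (λ z → Q₃ + suc z) (m+n∸m≡n r s)) eq))
        where
        s<r : s < r
        s<r = ≤-pred (+-cancelˡ-< Q₃ _ _ (subst (_< Q₃ + k₋₁) (sym eq) (subst (p <_) L≡ p<L)))

    bridge₁-valid : ∀ t → Valid (bridge₁ t)
    bridge₁-valid zero = <⇒≤ R₁.k₋₁<end , R₁.end≤top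
    bridge₁-valid (suc s) with s <? r
    ... | yes s<r = <-≤-trans s<r (m≤m*n r 2)
    ... | no _ = R₂.k₋₁≤start , <⇒≤ R₂.start<top
    bridge₂-valid : ∀ t → Valid (bridge₂ t)
    bridge₂-valid zero = <⇒≤ R₂.k₋₁<end , R₂.end≤top
    bridge₂-valid (suc s) with s <? r
    ... | yes s<r = <-≤-trans (+-monoʳ-< r s<r) (≤-reflexive r+r≡period)
    ... | no _ = R₁.k₋₁≤start , <⇒≤ R₁.start<top

    code-valid : ∀ {p} → p < L → Valid (code p)
    code-valid {p} p<L with B₁ <? p
    ... | no B₁≮p = subst Valid (sym (code-on₁ (≮⇒≥ B₁≮p))) (R₁.τ-range (k₋₁ + p) (m≤m+n k₋₁ p , +-monoʳ-≤ k₋₁ (≮⇒≥ B₁≮p)))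
    ... | yes B₁<p with Q₂ <? p
    ...   | no Q₂≮p = subst Valid (sym (code-bridge₁ B₁<p (≮⇒≥ Q₂≮p))) (bridge₁-valid (p ∸ B₁))
    ...   | yes Q₂<p with Q₃ <? p
    ...     | no Q₃≮p = subst Valid (sym (code-on₂ Q₂<p (≮⇒≥ Q₃≮p))) (R₂.τ-range (k₋₁ + (p ∸ Q₂))
                          (m≤m+n k₋₁ _ , +-monoʳ-≤ k₋₁ (≤-trans (∸-monoˡ-≤ Q₂ (≮⇒≥ Q₃≮p)) (≤-reflexive (m+n∸m≡n Q₂ B₂)))))
    ...     | yes Q₃<p = subst Valid (sym (code-bridge₂ Q₃<p)) (bridge₂-valid (p ∸ Q₃))

    S-injective : ∀ p p′ → p < L → p′ < L → S p ≡ S p′ → p ≡ p′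
    S-injective p p′ p<L p′<L eq =
      trans (sym (position-code p<L)) (trans (cong position (decode-injective (code-valid p<L) (code-valid p′<L) eq)) (position-code p′<L))

    Edge : ℕ → Subset N
    Edge e = toSub (applyUpTo (λ t → S (e * k₋₁ + t)) k)

    on₁-edge-blue : ∀ e → suc e ≤ m₁ → c (Edge e) ≡ blue
    on₁-edge-blue e 1+e≤m₁ = trans (cong c (trans (cong toSub (applyUpTo-cong k vertex))
      (toSub-applyUpTo-involution W₁ τ₁ (suc e * k₋₁) k₋₁ (λ o _ → R₁.τ-involutive o) (R₁.τ-edge (suc e) (s≤s z≤n) 1+e≤m₁))))
      (W₁-blue (suc e) (s≤s z≤n) 1+e≤m₁)
      where
      vertex : ∀ {t} → t < k → S (e * k₋₁ + t) ≡ W₁ (τ₁ (suc e * k₋₁ + t))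
      vertex {t} (s≤s t≤k₋₁) = trans (cong decode (code-on₁ bound)) (cong (W₁ ∘ τ₁) (sym (+-assoc k₋₁ (e * k₋₁) t)))
        where
        bound : e * k₋₁ + t ≤ B₁
        bound = ≤-trans (+-monoʳ-≤ (e * k₋₁) t≤k₋₁) (≤-trans (≤-reflexive (+-comm (e * k₋₁) k₋₁)) (*-monoˡ-≤ k₋₁ 1+e≤m₁))

    bridge₁-edge-blue : c (Edge m₁) ≡ blue
    bridge₁-edge-blue = trans (cong c (cong toSub (applyUpTo-cong k vertex))) bridge₁-blue
      where
      vertex : ∀ {t} → t < k → S (m₁ * k₋₁ + t) ≡ windowSeq end₁ start₂ α t
      vertex {zero} _ = trans (cong decode (code-on₁ (≤-reflexive (+-identityʳ B₁))))
                              (cong W₁ (trans (cong τ₁ (cong (k₋₁ +_) (+-identityʳ B₁))) R₁.τ-top))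
      vertex {suc s} (s≤s (s≤s s≤r)) = trans (cong decode (trans (code-bridge₁ (m<m+n B₁ (s≤s z≤n)) (+-monoʳ-≤ B₁ (s≤s s≤r)))
                                                                (cong bridge₁ (m+n∸m≡n B₁ (suc s)))))
                                             inner-or-last
        where
        inner-or-last : decode (bridge₁ (suc s)) ≡ windowSeq end₁ start₂ α (suc s)
        inner-or-last with m≤n⇒m<n∨m≡n s≤r
        ... | inj₁ s<r = trans (cong decode (bridge₁-inner s<r)) (sym (windowSeq-inner end₁ start₂ α s<r))
        ... | inj₂ refl = trans (cong decode bridge₁-last) (sym (windowSeq-last end₁ start₂ α))

    S-on₂ : ∀ {u} → u ≤ B₂ → S (Q₂ + u) ≡ W₂ (τ₂ (k₋₁ + u))
    S-on₂ {zero} _ = trans (cong decode (trans (code-bridge₁ (<-≤-trans (m<m+n B₁ (s≤s z≤n)) (≤-reflexive (sym (+-identityʳ Q₂))))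
                                                             (≤-reflexive (+-identityʳ Q₂)))
                                              (cong bridge₁ (trans (cong (_∸ B₁) (+-identityʳ Q₂)) (m+n∸m≡n B₁ k₋₁)))))
                           (trans (cong decode bridge₁-last) (cong W₂ (trans (sym R₂.τ-k₋₁) (cong τ₂ (sym (+-identityʳ k₋₁))))))
    S-on₂ {suc u} 1+u≤ = trans (cong decode (code-on₂ (m<m+n Q₂ (s≤s z≤n)) (+-monoʳ-≤ Q₂ 1+u≤)))
                               (cong (λ z → W₂ (τ₂ (k₋₁ + z))) (m+n∸m≡n Q₂ (suc u)))

    on₂-edge-blue : ∀ e → suc e ≤ m₂ → c (Edge (suc m₁ + e)) ≡ blue
    on₂-edge-blue e 1+e≤m₂ = trans (cong c (trans (cong toSub (applyUpTo-cong k vertex))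
      (toSub-applyUpTo-involution W₂ τ₂ (suc e * k₋₁) k₋₁ (λ o _ → R₂.τ-involutive o) (R₂.τ-edge (suc e) (s≤s z≤n) 1+e≤m₂))))
      (W₂-blue (suc e) (s≤s z≤n) 1+e≤m₂)
      where
      vertex : ∀ {t} → t < k → S ((suc m₁ + e) * k₋₁ + t) ≡ W₂ (τ₂ (suc e * k₋₁ + t))
      vertex {t} (s≤s t≤k₋₁) = trans (cong S offset) (trans (S-on₂ bound) (cong (W₂ ∘ τ₂) (sym (+-assoc k₋₁ (e * k₋₁) t))))
        where
        offset : (suc m₁ + e) * k₋₁ + t ≡ Q₂ + (e * k₋₁ + t)
        offset = solve 4 (λ a b κ t → ((con 1 :+ a) :+ b) :* κ :+ t := (a :* κ :+ κ) :+ (b :* κ :+ t)) refl m₁ e k₋₁ t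
        bound : e * k₋₁ + t ≤ B₂
        bound = ≤-trans (+-monoʳ-≤ (e * k₋₁) t≤k₋₁) (≤-trans (≤-reflexive (+-comm (e * k₋₁) k₋₁)) (*-monoˡ-≤ k₋₁ 1+e≤m₂))

    S-bridge₂ : ∀ {t} → t ≤ k₋₁ → S (Q₃ + t) ≡ windowSeq end₂ start₁ (α + r) t
    S-bridge₂ {zero} _ = trans (cong decode (code-on₂ Q₂<Q₃ (≤-reflexive (+-identityʳ Q₃))))
      (cong W₂ (trans (cong τ₂ (cong (k₋₁ +_) (trans (cong (_∸ Q₂) (+-identityʳ Q₃)) (m+n∸m≡n Q₂ B₂)))) R₂.τ-top))
      where
      Q₂<Q₃ : Q₂ < Q₃ + 0
      Q₂<Q₃ = <-≤-trans (m<m+n Q₂ (≤-trans (s≤s z≤n) R₂.k₋₁≤m*k₋₁)) (≤-reflexive (sym (+-identityʳ Q₃)))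
    S-bridge₂ {suc s} (s≤s s≤r) = trans (cong decode (trans (code-bridge₂ (m<m+n Q₃ (s≤s z≤n))) (cong bridge₂ (m+n∸m≡n Q₃ (suc s)))))
                                        inner-or-last
      where
      inner-or-last : decode (bridge₂ (suc s)) ≡ windowSeq end₂ start₁ (α + r) (suc s)
      inner-or-last with m≤n⇒m<n∨m≡n s≤r
      ... | inj₁ s<r = trans (cong decode (bridge₂-inner s<r)) (trans (cong x (sym (+-assoc α r s)))
                                                                      (sym (windowSeq-inner end₂ start₁ (α + r) s<r)))
      ... | inj₂ refl = trans (cong decode bridge₂-last) (sym (windowSeq-last end₂ start₁ (α + r)))

    bridge₂-edge-blue : c (Edge (suc m₁ + m₂)) ≡ blue
    bridge₂-edge-blue = trans (cong c (cong toSub (applyUpTo-cong k vertex))) bridge₂-blue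
      where
      vertex : ∀ {t} → t < k → S ((suc m₁ + m₂) * k₋₁ + t) ≡ windowSeq end₂ start₁ (α + r) t
      vertex {t} (s≤s t≤k₋₁) = trans (cong S (solve 4 (λ a b κ t → ((con 1 :+ a) :+ b) :* κ :+ t := ((a :* κ :+ κ) :+ b :* κ) :+ t)
                                                       refl m₁ m₂ k₋₁ t))
                                     (S-bridge₂ t≤k₋₁)

    S-periodic : S L ≡ S 0
    S-periodic = trans (cong S L≡) (trans (S-bridge₂ ≤-refl) (trans (windowSeq-last end₂ start₁ (α + r))
      (sym (trans (cong decode (code-on₁ z≤n)) (cong W₁ (trans (cong τ₁ (+-identityʳ k₋₁)) R₁.τ-k₋₁))))))

    Edge-blue : ∀ e → e < suc m₁ + suc m₂ → c (Edge e) ≡ blue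
    Edge-blue e e< with e <? m₁
    ... | yes e<m₁ = on₁-edge-blue e e<m₁
    ... | no e≮m₁ with e ≟ m₁
    ...   | yes refl = bridge₁-edge-blue
    ...   | no e≢m₁ = subst (λ z → c (Edge z) ≡ blue) e≡ (second-half (e ∸ suc m₁) d<)
      where
      e≡ : suc m₁ + (e ∸ suc m₁) ≡ e
      e≡ = m+[n∸m]≡n (≤∧≢⇒< (≮⇒≥ e≮m₁) (e≢m₁ ∘ sym))
      d< : e ∸ suc m₁ < suc m₂
      d< = +-cancelˡ-< (suc m₁) _ _ (subst (_< suc m₁ + suc m₂) (sym e≡) e<)
      second-half : ∀ d → d < suc m₂ → c (Edge (suc m₁ + d)) ≡ blue
      second-half d (s≤s d≤m₂) with m≤n⇒m<n∨m≡n d≤m₂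
      ... | inj₁ d<m₂ = on₂-edge-blue d d<m₂
      ... | inj₂ refl = bridge₂-edge-blue

    blue-cycle : ∃[ φ ] IsLooseCycle c blue k (suc m₁ + suc m₂) φ
    blue-cycle = cycle , cycle-injective S-injective , all-blue
      where
      open SequenceAsCycle k₋₁ L S
      all-blue : ∀ (e : Fin (suc m₁ + suc m₂)) → c (cycEdge k cycle (toℕ e)) ≡ blue
      all-blue e = trans (cong c (cycEdge-cycle (toℕ e) bound S-periodic)) (Edge-blue (toℕ e) (Finₚ.toℕ<n e))
        where
        bound : toℕ e * k₋₁ + k₋₁ ≤ L
        bound = ≤-trans (≤-reflexive (+-comm (toℕ e * k₋₁) k₋₁))
                        (≤-trans (*-monoˡ-≤ k₋₁ (Finₚ.toℕ<n e)) (≤-reflexive (*-comm (suc m₁ + suc m₂) k₋₁)))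

  private
    top₁≤L₁ : k₋₁ + m₁ * k₋₁ ≤ L₁
    top₁≤L₁ = ≤-reflexive (*-comm (suc m₁) k₋₁)
    top₂≤L₂ : k₋₁ + m₂ * k₋₁ ≤ L₂
    top₂≤L₂ = ≤-reflexive (*-comm (suc m₂) k₋₁)

    V₁-outer : ∀ o → OnPath m₁ o → ∃[ o′ ] (k₋₁ ≤ o′ × o′ ≤ L₁ × V₁ o ≡ V₁ o′)
    V₁-outer o (k₋₁≤o , o≤top) = o , k₋₁≤o , ≤-trans o≤top top₁≤L₁ , refl
    V₂-outer : ∀ o → OnPath m₂ o → ∃[ o′ ] (k₋₁ ≤ o′ × o′ ≤ L₂ × V₂ o ≡ V₂ o′)
    V₂-outer o (k₋₁≤o , o≤top) = o , k₋₁≤o , ≤-trans o≤top top₂≤L₂ , refl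

    V₁-injective-outer : ∀ o o′ → OnPath m₁ o → OnPath m₁ o′ → V₁ o ≡ V₁ o′ → o ≡ o′
    V₁-injective-outer o o′ (k₋₁≤o , o≤) (k₋₁≤o′ , o′≤) =
      V₁-injective (≤-trans (s≤s z≤n) k₋₁≤o) (≤-trans o≤ top₁≤L₁) (≤-trans (s≤s z≤n) k₋₁≤o′) (≤-trans o′≤ top₁≤L₁)
    V₂-injective-outer : ∀ o o′ → OnPath m₂ o → OnPath m₂ o′ → V₂ o ≡ V₂ o′ → o ≡ o′
    V₂-injective-outer o o′ (k₋₁≤o , o≤) (k₋₁≤o′ , o′≤) =
      V₂-injective (≤-trans (s≤s z≤n) k₋₁≤o) (≤-trans o≤ top₂≤L₂) (≤-trans (s≤s z≤n) k₋₁≤o′) (≤-trans o′≤ top₂≤L₂)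

    start≢end₁ : k₋₁ + a″ ≢ m₁ * k₋₁ + a′
    start≢end₁ eq = v′≢v″ (trans v′≡ (trans (cong V₁ (sym eq)) (sym v″≡)))

  no-straight-blue-pair : ∀ α → c (window v′ u″ α) ≡ blue → c (window v″ u′ (α + r)) ≡ blue → ⊥
  no-straight-blue-pair α first-blue second-blue = no-blue-cycle (Glue.blue-cycle record
    { W₁ = V₁ ; W₂ = V₂ ; a₀ = a″ ; a₁ = a′ ; b₀ = b″ ; b₁ = b′ ; α = α
    ; W₁-outer = V₁-outer ; W₂-outer = V₂-outer ; W₁-injective = V₁-injective-outer ; W₂-injective = V₂-injective-outer
    ; W₁-blue = λ d _ _ → edge₁-blue d ; W₂-blue = λ d _ _ → edge₂-blue d
    ; a₀≤r = a″≤r ; 1≤a₁ = 1≤a′ ; a₁≤k₋₁ = a′≤k₋₁ ; b₀≤r = b″≤r ; 1≤b₁ = 1≤b′ ; b₁≤k₋₁ = b′≤k₋₁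
    ; start≢end₁ = start≢end₁
    ; start≢end₂ = λ eq → u′≢u″ (trans u′≡ (trans (cong V₂ (sym eq)) (sym u″≡)))
    ; bridge₁-blue = subst₂ (λ p q → c (window p q α) ≡ blue) v′≡ u″≡ first-blue
    ; bridge₂-blue = subst₂ (λ p q → c (window p q (α + r)) ≡ blue) u′≡ v″≡
                            (trans (cong c (window-comm u′ v″ (α + r))) second-blue)
    })

  private
    top₂ : ℕ
    top₂ = k₋₁ + m₂ * k₋₁

    reflect : ℕ → ℕ
    reflect o = top₂ + k₋₁ ∸ o

    -- C₂ read backwards, so that it runs from u′ to u″.
    V₂ᵒᵖ : ℕ → Fin N
    V₂ᵒᵖ o = V₂ (reflect o)

    reflect-range : ∀ o → InRange k₋₁ top₂ o → InRange k₋₁ top₂ (reflect o)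
    reflect-range o (k₋₁≤o , o≤top) = ≤-trans (≤-reflexive (sym (m+n∸m≡n top₂ k₋₁))) (∸-monoʳ-≤ (top₂ + k₋₁) o≤top)
                                    , ≤-trans (∸-monoʳ-≤ (top₂ + k₋₁) k₋₁≤o) (≤-reflexive (m+n∸n≡m top₂ k₋₁))

    V₂ᵒᵖ-outer : ∀ o → InRange k₋₁ top₂ o → ∃[ o′ ] (k₋₁ ≤ o′ × o′ ≤ L₂ × V₂ᵒᵖ o ≡ V₂ o′)
    V₂ᵒᵖ-outer o o∈ = reflect o , proj₁ (reflect-range o o∈) , ≤-trans (proj₂ (reflect-range o o∈)) top₂≤L₂ , refl

    V₂ᵒᵖ-injective : ∀ o o′ → InRange k₋₁ top₂ o → InRange k₋₁ top₂ o′ → V₂ᵒᵖ o ≡ V₂ᵒᵖ o′ → o ≡ o′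
    V₂ᵒᵖ-injective o o′ o∈ o′∈ eq = trans (sym (m∸[m∸n]≡n (≤-trans (proj₂ o∈) (m≤m+n top₂ k₋₁))))
      (trans (cong (top₂ + k₋₁ ∸_) (V₂-injective-outer _ _ (reflect-range o o∈) (reflect-range o′ o′∈) eq))
             (m∸[m∸n]≡n (≤-trans (proj₂ o′∈) (m≤m+n top₂ k₋₁))))

    reflect-by-sum : ∀ o o′ → o + o′ ≡ top₂ + k₋₁ → reflect o ≡ o′
    reflect-by-sum o o′ eq = trans (cong (_∸ o) (sym eq)) (m+n∸m≡n o o′)

    reflect-edge : ∀ d t → d ≤ m₂ → t ≤ k₋₁ → reflect (d * k₋₁ + t) ≡ suc (m₂ ∸ d) * k₋₁ + (k₋₁ ∸ t)
    reflect-edge d t d≤m₂ t≤k₋₁ = reflect-by-sum (d * k₋₁ + t) (suc (m₂ ∸ d) * k₋₁ + (k₋₁ ∸ t)) (trans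
      (solve 5 (λ d t q u κ → d :* κ :+ t :+ ((con 1 :+ q) :* κ :+ u) := κ :+ (d :+ q) :* κ :+ (t :+ u)) refl d t (m₂ ∸ d) (k₋₁ ∸ t) k₋₁)
      (cong₂ (λ z w → k₋₁ + z * k₋₁ + w) (m+[n∸m]≡n d≤m₂) (m+[n∸m]≡n t≤k₋₁)))

    V₂ᵒᵖ-blue : ∀ d → 1 ≤ d → d ≤ m₂ → c (toSub (applyUpTo (λ t → V₂ᵒᵖ (d * k₋₁ + t)) k)) ≡ blue
    V₂ᵒᵖ-blue d _ d≤m₂ = trans (cong c (trans (cong toSub (applyUpTo-cong k vertex))
      (toSub-applyUpTo-involution (λ u → V₂ (d′ * k₋₁ + u)) (k₋₁ ∸_) 0 k₋₁ (λ _ o∈ → m∸[m∸n]≡n (proj₂ o∈)) (λ o _ → z≤n , m∸n≤m k₋₁ o))))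
      (edge₂-blue d′)
      where
      d′ : ℕ
      d′ = suc (m₂ ∸ d)
      vertex : ∀ {t} → t < k → V₂ᵒᵖ (d * k₋₁ + t) ≡ V₂ (d′ * k₋₁ + (k₋₁ ∸ t))
      vertex {t} (s≤s t≤k₋₁) = cong V₂ (reflect-edge d t d≤m₂ t≤k₋₁)

    V₂ᵒᵖ-start : V₂ᵒᵖ (k₋₁ + (k₋₁ ∸ b′)) ≡ u′
    V₂ᵒᵖ-start = trans (cong V₂ (reflect-by-sum (k₋₁ + (k₋₁ ∸ b′)) (m₂ * k₋₁ + b′) (trans
      (solve 4 (λ κ b m s → κ :+ b :+ (m :* κ :+ s) := κ :+ m :* κ :+ (b :+ s)) refl k₋₁ (k₋₁ ∸ b′) m₂ b′)
      (cong (top₂ +_) (m∸n+n≡m b′≤k₋₁))))) (sym u′≡)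

    V₂ᵒᵖ-end : V₂ᵒᵖ (m₂ * k₋₁ + (k₋₁ ∸ b″)) ≡ u″
    V₂ᵒᵖ-end = trans (cong V₂ (reflect-by-sum (m₂ * k₋₁ + (k₋₁ ∸ b″)) (k₋₁ + b″) (trans
      (solve 4 (λ κ b m s → m :* κ :+ b :+ (κ :+ s) := κ :+ m :* κ :+ (b :+ s)) refl k₋₁ (k₋₁ ∸ b″) m₂ b″)
      (cong (top₂ +_) (m∸n+n≡m (≤-trans b″≤r (n≤1+n r))))))) (sym u″≡)

  no-crossed-blue-pair : ∀ α → c (window v′ u′ α) ≡ blue → c (window v″ u″ (α + r)) ≡ blue → ⊥
  no-crossed-blue-pair α first-blue second-blue = no-blue-cycle (Glue.blue-cycle record
    { W₁ = V₁ ; W₂ = V₂ᵒᵖ ; a₀ = a″ ; a₁ = a′ ; b₀ = k₋₁ ∸ b′ ; b₁ = k₋₁ ∸ b″ ; α = α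
    ; W₁-outer = V₁-outer ; W₂-outer = V₂ᵒᵖ-outer ; W₁-injective = V₁-injective-outer ; W₂-injective = V₂ᵒᵖ-injective
    ; W₁-blue = λ d _ _ → edge₁-blue d ; W₂-blue = V₂ᵒᵖ-blue
    ; a₀≤r = a″≤r ; 1≤a₁ = 1≤a′ ; a₁≤k₋₁ = a′≤k₋₁
    ; b₀≤r = ∸-monoʳ-≤ k₋₁ 1≤b′ ; 1≤b₁ = m<n⇒0<n∸m (s≤s b″≤r) ; b₁≤k₋₁ = m∸n≤m k₋₁ b″
    ; start≢end₁ = start≢end₁
    ; start≢end₂ = λ eq → u′≢u″ (trans (sym V₂ᵒᵖ-start) (trans (cong V₂ᵒᵖ eq) V₂ᵒᵖ-end))
    ; bridge₁-blue = subst₂ (λ p q → c (window p q α) ≡ blue) v′≡ (sym V₂ᵒᵖ-start) first-blue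
    ; bridge₂-blue = subst₂ (λ p q → c (window p q (α + r)) ≡ blue) (sym V₂ᵒᵖ-end) v″≡
                            (trans (cong c (window-comm u″ v″ (α + r))) second-blue)
    })

module Conclusion {N : ℕ} (P : TwoCycles N) (Q : Endpoints P) where
  open TwoCycles P
  open Endpoints Q
  open Interleaving P
  open RedPaths P Q
  open BlueCycles P Q using (no-straight-blue-pair; no-crossed-blue-pair)

  A B C D : ℕ → Subset N
  A = window v′ u″
  B = window v′ u′
  C = window v″ u′
  D = window v″ u″

  colour-cases : ∀ (z : Colour) → z ≡ red ⊎ z ≡ blue
  colour-cases red = inj₁ refl
  colour-cases blue = inj₂ refl

  half-turn : ∀ p q → window p q (r + r) ≡ window p q 0
  half-turn p q = trans (cong (window p q) r+r≡period) (window-periodic p q 0)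

  path-A-B : ∀ α → c (A α) ≡ red → c (B (α + r)) ≡ red → Goal
  path-A-B α A-red B-red = SharedEndpoint.path u″ v′ u′ u″-valid v′-valid u′-valid (v′≢u″ ∘ sym) (u′≢u″ ∘ sym) v′≢u′ α
    (trans (cong c (window-comm u″ v′ α)) A-red) B-red
  path-A-D : ∀ α → c (A α) ≡ red → c (D (α + r)) ≡ red → Goal
  path-A-D α A-red D-red = SharedEndpoint.path v′ u″ v″ v′-valid u″-valid v″-valid v′≢u″ v′≢v″ (v″≢u″ ∘ sym) α
    A-red (trans (cong c (window-comm u″ v″ (α + r))) D-red)
  path-C-B : ∀ α → c (C α) ≡ red → c (B (α + r)) ≡ red → Goal
  path-C-B α C-red B-red = SharedEndpoint.path v″ u′ v′ v″-valid u′-valid v′-valid v″≢u′ (v′≢v″ ∘ sym) (v′≢u′ ∘ sym) α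
    C-red (trans (cong c (window-comm u′ v′ (α + r))) B-red)
  path-C-D : ∀ α → c (C α) ≡ red → c (D (α + r)) ≡ red → Goal
  path-C-D α C-red D-red = SharedEndpoint.path u′ v″ u″ u′-valid v″-valid u″-valid (v″≢u′ ∘ sym) u′≢u″ v″≢u″ α
    (trans (cong c (window-comm u′ v″ α)) C-red) D-red

  A-step : ∀ α → c (A α) ≡ red → c (A (suc α)) ≡ red ⊎ Goal
  A-step α A-red with colour-cases (c (A (suc α)))
  ... | inj₁ A′-red = inj₁ A′-red
  ... | inj₂ A′-blue with colour-cases (c (C (suc α + r)))
  ...   | inj₂ C-blue = ⊥-elim (no-straight-blue-pair (suc α) A′-blue C-blue)
  ...   | inj₁ C-red = inj₂ (SharedInnerVertex.path α C-red A-red)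

  A-steps : ∀ n α → c (A α) ≡ red → c (A (α + n)) ≡ red ⊎ Goal
  A-steps zero α A-red = inj₁ (subst (λ z → c (A z) ≡ red) (sym (+-identityʳ α)) A-red)
  A-steps (suc n) α A-red with A-step α A-red
  ... | inj₂ goal = inj₂ goal
  ... | inj₁ A′-red with A-steps n (suc α) A′-red
  ...   | inj₂ goal = inj₂ goal
  ...   | inj₁ A″-red = inj₁ (subst (λ z → c (A z) ≡ red) (sym (+-suc α n)) A″-red)

  B₀-red : c (D r) ≡ blue → c (B 0) ≡ red
  B₀-red D-blue with colour-cases (c (B 0))
  ... | inj₁ B-red = B-red
  ... | inj₂ B-blue = ⊥-elim (no-crossed-blue-pair 0 B-blue D-blue)

  goal-if-A₀-red : c (A 0) ≡ red → Goal
  goal-if-A₀-red A₀-red with A-steps r 0 A₀-red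
  ... | inj₂ goal = goal
  ... | inj₁ Aᵣ-red with colour-cases (c (D r))
  ...   | inj₁ D-red = path-A-D 0 A₀-red D-red
  ...   | inj₂ D-blue = path-A-B r Aᵣ-red (trans (cong c (half-turn v′ u′)) (B₀-red D-blue))

  goal-if-A₀-blue : c (A 0) ≡ blue → Goal
  goal-if-A₀-blue A₀-blue with colour-cases (c (C r))
  ... | inj₂ Cᵣ-blue = ⊥-elim (no-straight-blue-pair 0 A₀-blue Cᵣ-blue)
  ... | inj₁ Cᵣ-red with colour-cases (c (A r))
  ...   | inj₁ Aᵣ-red with A-steps r r Aᵣ-red
  ...     | inj₂ goal = goal
  ...     | inj₁ A₂ᵣ-red = ⊥-elim (red≢blue (trans (sym (trans (cong c (sym (half-turn v′ u″))) A₂ᵣ-red)) A₀-blue))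
    where
    red≢blue : red ≢ blue
    red≢blue ()
  goal-if-A₀-blue A₀-blue | inj₁ Cᵣ-red | inj₂ Aᵣ-blue with colour-cases (c (C (r + r)))
  ...   | inj₂ C₂ᵣ-blue = ⊥-elim (no-straight-blue-pair r Aᵣ-blue C₂ᵣ-blue)
  ...   | inj₁ C₂ᵣ-red with colour-cases (c (D r))
  ...     | inj₁ D-red = path-C-D 0 (trans (cong c (sym (half-turn v″ u′))) C₂ᵣ-red) D-red
  ...     | inj₂ D-blue = path-C-B r Cᵣ-red (trans (cong c (half-turn v′ u′)) (B₀-red D-blue))

  goal : Goal
  goal with colour-cases (c (A 0))
  ... | inj₁ A₀-red = goal-if-A₀-red A₀-red
  ... | inj₂ A₀-blue = goal-if-A₀-blue A₀-blue

lemma4 : (n k l₁ l₂ : ℕ) → 5 ≤ n → 8 ≤ k → 2 ≤ l₁ → l₁ ≤ l₂ → l₁ + l₂ ≤ n →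
    (c : Colouring (Hsize n k)) →
    (φ₁ : Fin ((k ∸ 1) * l₁) → Fin (Hsize n k)) →
    (φ₂ : Fin ((k ∸ 1) * l₂) → Fin (Hsize n k)) →
    IsLooseCycle c blue k l₁ φ₁ → IsLooseCycle c blue k l₂ φ₂ →
    (∀ a b → φ₁ a ≢ φ₂ b) →
    2 ≤ ∣ ∁ (image φ₁ ∪ image φ₂) ∣ →
    (i : Fin l₁) (j : Fin l₂) (v′ v″ u′ u″ : Fin (Hsize n k)) →
    v′ ≢ v″ → v′ ≢ u′ → v′ ≢ u″ → v″ ≢ u′ → v″ ≢ u″ → u′ ≢ u″ →
    v′ ∈ cycEdge k φ₁ (toℕ i + l₁ ∸ 1) → v′ ∉ cycFirst k φ₁ (toℕ i + l₁ ∸ 1) →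
    v″ ∈ cycEdge k φ₁ (toℕ i + 1) → v″ ∉ cycLast k φ₁ (toℕ i + 1) →
    u′ ∈ cycEdge k φ₂ (toℕ j + l₂ ∸ 1) → u′ ∉ cycFirst k φ₂ (toℕ j + l₂ ∸ 1) →
    u″ ∈ cycEdge k φ₂ (toℕ j + 1) → u″ ∉ cycLast k φ₂ (toℕ j + 1) →
    ¬ (∃[ φ ] IsLooseCycle c blue k (l₁ + l₂) φ) →
    ∃[ ψ ] (IsLoosePath c red k 2 ψ
      × image ψ ⊆ (cycInner k φ₁ (toℕ i) ∪ cycInner k φ₂ (toℕ j)
                    ∪ (⁅ v′ ⁆ ∪ ⁅ v″ ⁆ ∪ ⁅ u′ ⁆ ∪ ⁅ u″ ⁆))
      × ((m : Fin 2) →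
           (3 ≤ ∣ pathEdge k ψ (toℕ m) ∩ cycInner k φ₁ (toℕ i) ∣)
         × (3 ≤ ∣ pathEdge k ψ (toℕ m) ∩ cycInner k φ₂ (toℕ j) ∣)))
lemma4 n (suc (suc r)) (suc m₁) zero _ _ _ () _
lemma4 n (suc (suc r)) (suc m₁) (suc m₂) _ (s≤s (s≤s 6≤r)) (s≤s 1≤m₁) (s≤s m₁≤m₂) _ c φ₁ φ₂ cycle₁ cycle₂ disjoint _
       i j v′ v″ u′ u″ v′≢v″ _ _ _ _ u′≢u″ v′∈ v′∉ v″∈ v″∉ u′∈ u′∉ u″∈ u″∉ no-blue-cycle =
  let a′ , 1≤a′ , a′≤k₋₁ , v′≡ = pred-vertex₁ v′∈ v′∉
      a″ , a″≤r , v″≡ = succ-vertex₁ v″∈ v″∉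
      b′ , 1≤b′ , b′≤k₋₁ , u′≡ = pred-vertex₂ u′∈ u′∉
      b″ , b″≤r , u″≡ = succ-vertex₂ u″∈ u″∉
  in Conclusion.goal P record
       { 1≤m₁ = 1≤m₁ ; 1≤m₂ = ≤-trans 1≤m₁ m₁≤m₂ ; v′ = v′ ; v″ = v″ ; u′ = u′ ; u″ = u″
       ; a′ = a′ ; a″ = a″ ; b′ = b′ ; b″ = b″
       ; 1≤a′ = 1≤a′ ; a′≤k₋₁ = a′≤k₋₁ ; v′≡ = v′≡ ; a″≤r = a″≤r ; v″≡ = v″≡
       ; 1≤b′ = 1≤b′ ; b′≤k₋₁ = b′≤k₋₁ ; u′≡ = u′≡ ; b″≤r = b″≤r ; u″≡ = u″≡
       ; v′≢v″ = v′≢v″ ; u′≢u″ = u′≢u″ ; no-blue-cycle = no-blue-cycle }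
  where
  P : TwoCycles _
  P = record { c = c ; r = r ; 6≤r = 6≤r ; m₁ = m₁ ; m₂ = m₂ ; i = toℕ i ; j = toℕ j ; φ₁ = φ₁ ; φ₂ = φ₂
             ; cycle₁ = cycle₁ ; cycle₂ = cycle₂ ; disjoint = disjoint }
  open Interleaving P using (pred-vertex₁; succ-vertex₁; pred-vertex₂; succ-vertex₂)
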